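{- Let $k\ge 1$ and $s\ge 1$ be integers. Every $k$-uniform $[1,s]$-almost intersecting multihypergraph has at most $s\binom{2k}{k}$ edges (counted with multiplicity). Moreover, up to isomorphism the unique such multihypergraph with exactly $s\binom{2k}{k}$ edges is the multihypergraph consisting of all $k$-element subsets of $[2k]$, each taken with multiplicity $s$; this multihypergraph is $s$-almost intersecting.
   Context: A $k$-uniform multihypergraph is a finite collection of $k$-element sets (edges) in which repeated edges are allowed; distinct copies of the same set count as distinct edges. For integers $0\le a\le b$, a (multi)hypergraph $\mathcal{F}$ is $[a,b]$-almost intersecting if for every edge $A\in\mathcal{F}$ the number of edges $B\in\mathcal{F}$ with $A\cap B=\emptyset$ (copies counted separately) lies between $a$ and $b$ inclusive. It is $s$-almost intersecting if it is $[s,s]$-almost intersecting. $[n]=\{1,\dots,n\}$. -}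

module Defs where

open import Data.Nat using (ℕ; zero; suc; _≟_; _*_; _≤_)
open import Data.Bool using (Bool; true; false)
open import Data.Fin using (Fin)
import Data.Fin as Fin
open import Data.Fin.Subset using (Subset; _∩_; ∣_∣; inside; outside; _∈_; Empty)
open import Data.Fin.Subset.Properties using (_∈?_; nonempty?)
open import Data.Fin.Properties using (any?)
open import Data.List using (List; []; _∷_; _++_; map; filter; length; concatMap; replicate)
open import Data.List.Relation.Unary.All using (All)
open import Data.Vec using (Vec; []; _∷_; tabulate)
open import Data.Product using (_×_)
open import Relation.Nullary using (¬?; does)
open import Relation.Nullary.Decidable using (_×-dec_)
open import Function.Definitions using (Injective)
open import Relation.Binary.PropositionalEquality using (_≡_)

-- A multihypergraph on the vertex set Fin n: a finite list of edges
-- (subsets of Fin n); repeated entries are distinct copies of an edge.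
MultiHypergraph : ℕ → Set
MultiHypergraph n = List (Subset n)

Uniform : ∀ {n} → ℕ → MultiHypergraph n → Set
Uniform k F = All (λ A → ∣ A ∣ ≡ k) F

disjointCount : ∀ {n} → Subset n → MultiHypergraph n → ℕ
disjointCount A F = length (filter (λ B → ¬? (nonempty? (A ∩ B))) F)

AlmostIntersecting : ∀ {n} → ℕ → ℕ → MultiHypergraph n → Set
AlmostIntersecting a b F = All (λ A → a ≤ disjointCount A F × disjointCount A F ≤ b) F

SAlmostIntersecting : ∀ {n} → ℕ → MultiHypergraph n → Set
SAlmostIntersecting s F = AlmostIntersecting s s F

allSubsets : (n : ℕ) → List (Subset n)
allSubsets zero = [] ∷ []
allSubsets (suc n) = map (inside ∷_) (allSubsets n) ++ map (outside ∷_) (allSubsets n)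

kSubsets : (n k : ℕ) → List (Subset n)
kSubsets n k = filter (λ A → ∣ A ∣ ≟ k) (allSubsets n)

standard : (k s : ℕ) → MultiHypergraph (2 * k)
standard k s = concatMap (replicate s) (kSubsets (2 * k) k)

image : ∀ {m n} → (Fin m → Fin n) → Subset m → Subset n
image f A = tabulate (λ j → does (any? (λ i → (i ∈? A) ×-dec (f i Fin.≟ j))))

-- Katona-type averaging over the orderings of the vertex set. Give every edge A a disjoint partner edge
-- p A and call A early in an ordering π when all of A comes before all of p A. If B is the edge whose
-- first vertex comes last, an early edge enters before its partner and hence before B, so it is disjoint
-- from B: at most s edges are early. A fixed edge is early in a fraction k! k! / (2k)! of the n! orderings,
-- and averaging gives ∣F∣ ≤ s (2k choose k).
--
-- With equality every ordering has exactly s early edges, whatever the partners. Orderings that put chosen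
-- vertices last then show that every edge is disjoint from exactly s edges, that the edges disjoint from
-- some edge disjoint from D all equal D, and that exchanging a vertex of an edge for a vertex of a disjoint
-- edge gives an edge. So for X = A₀ ∪ p A₀ every k-subset of X is an edge of multiplicity s, and these
-- s (2k choose k) edges are all of F.

module Submission where

open import Data.Nat
  using (ℕ; zero; suc; _+_; _*_; _∸_; _⊓_; _≤_; _<_; _<?_; _≟_; z≤n; s≤s; _!; NonZero; ≢-nonZero; ≢-nonZero⁻¹)
open import Data.Nat.Properties
open import Data.Nat.Combinatorics using (_C_; k![n∸k]!∣n!; nCk+nC[k+1]≡[n+1]C[k+1])
open import Data.Nat.Combinatorics.Specification using (nCk≡n!/k![n-k]!)
open import Data.Nat.DivMod using (_/_; m/n*n≡m)
open import Data.Nat.ListAction using (sum)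
open import Data.Nat.Tactic.RingSolver using (solve-∀)
open import Algebra.Properties.CommutativeSemigroup +-commutativeSemigroup using (x∙yz≈y∙xz; interchange)
open import Algebra.Properties.Semiring.Sum +-*-semiring using (sum-syntax; sum-cong-≗; ∑-distrib-+; *-distribˡ-sum; *-distribʳ-sum)
open import Data.Bool using (if_then_else_)
import Data.Bool.Properties as Bool
open import Data.Fin using (Fin; zero; suc)
import Data.Fin.Properties as Fin
open import Data.Fin.Subset
open import Data.Fin.Subset.Properties
open import Data.Vec using ([]; _∷_; here; there; lookup)
import Data.Vec.Properties as Vec
open import Data.List using (List; []; _∷_; _++_; map; filter; length; concat; concatMap; replicate; tabulate)
open import Data.List.Properties using (length-++; length-map; length-replicate; filter-++; filter-complete; map-cong)
open import Data.List.Membership.Propositional using (find; lose) renaming (_∈_ to _∈ₗ_)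
open import Data.List.Membership.Propositional.Properties using (∈-∃++; ∈-filter⁻; ∈-map⁺; ∈-++⁺ˡ; ∈-++⁺ʳ)
open import Data.List.Relation.Unary.Any using (here; there; any?)
import Data.List.Relation.Unary.All as All
import Data.List.Relation.Unary.All.Properties as AllP
open import Data.List.Extrema.Nat using (argmax; f[xs]≤f[argmax]; argmax-sel)
open import Data.List.Relation.Binary.Permutation.Propositional using (_↭_; ↭-refl; ↭-trans; ↭-sym; prep)
open import Data.List.Relation.Binary.Permutation.Propositional.Properties using (shift; ↭-length)
open import Data.Product using (Σ; _×_; _,_; proj₁; proj₂; ∃-syntax)
open import Data.Sum using (_⊎_; inj₁; inj₂)
open import Data.Empty using (⊥-elim)
open import Function using (_∘_; case_of_)
open import Function.Definitions using (Injective)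
open import Relation.Nullary using (Dec; yes; no; ¬_; ¬?; does)
open import Relation.Nullary.Decidable using (_×-dec_; _→-dec_)
open import Relation.Unary using (Decidable)
open import Relation.Binary.Definitions using (DecidableEquality)
open import Relation.Binary.PropositionalEquality

open import Defs

-- Counting in lists

indicator : {P : Set} → Dec P → ℕ
indicator P? = if does P? then 1 else 0

indicator-yes : {P : Set} (P? : Dec P) → P → indicator P? ≡ 1
indicator-yes (yes _) _ = refl
indicator-yes (no ¬p) p = ⊥-elim (¬p p)

indicator-no : {P : Set} (P? : Dec P) → ¬ P → indicator P? ≡ 0
indicator-no (yes p) ¬p = ⊥-elim (¬p p)
indicator-no (no _) _ = refl

indicator≤1 : {P : Set} (P? : Dec P) → indicator P? ≤ 1
indicator≤1 (yes _) = s≤s z≤n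
indicator≤1 (no _) = z≤n

length≢0⇒∃∈ : {A : Set} (xs : List A) → length xs ≢ 0 → ∃[ x ] x ∈ₗ xs
length≢0⇒∃∈ [] length≢0 = ⊥-elim (length≢0 refl)
length≢0⇒∃∈ (x ∷ _) _ = x , here refl

module _ {A : Set} where

  count : {P : A → Set} → Decidable P → List A → ℕ
  count P? xs = length (filter P? xs)

  count-∷ : {P : A → Set} (P? : Decidable P) (x : A) (xs : List A) →
            count P? (x ∷ xs) ≡ indicator (P? x) + count P? xs
  count-∷ P? x xs with P? x
  ... | yes _ = refl
  ... | no _ = refl

  count-++ : {P : A → Set} (P? : Decidable P) (xs ys : List A) →
             count P? (xs ++ ys) ≡ count P? xs + count P? ys
  count-++ P? xs ys = trans (cong length (filter-++ P? xs ys)) (length-++ (filter P? xs))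

  count-filter : {P Q : A → Set} (P? : Decidable P) (Q? : Decidable Q) (xs : List A) →
                 count P? (filter Q? xs) ≡ count (λ x → P? x ×-dec Q? x) xs
  count-filter P? Q? [] = refl
  count-filter P? Q? (x ∷ xs) with Q? x
  ... | yes _ with P? x
  ...   | yes _ = cong suc (count-filter P? Q? xs)
  ...   | no _ = count-filter P? Q? xs
  count-filter P? Q? (x ∷ xs) | no _ with P? x
  ...   | yes _ = count-filter P? Q? xs
  ...   | no _ = count-filter P? Q? xs

  count-mono : {P Q : A → Set} (P? : Decidable P) (Q? : Decidable Q) (xs : List A) →
               (∀ {x} → x ∈ₗ xs → P x → Q x) → count P? xs ≤ count Q? xs
  count-mono P? Q? [] P⇒Q = z≤n
  count-mono P? Q? (x ∷ xs) P⇒Q with P? x | Q? x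
  ... | yes p | yes q = s≤s (count-mono P? Q? xs (P⇒Q ∘ there))
  ... | yes p | no ¬q = ⊥-elim (¬q (P⇒Q (here refl) p))
  ... | no ¬p | yes q = m≤n⇒m≤1+n (count-mono P? Q? xs (P⇒Q ∘ there))
  ... | no ¬p | no ¬q = count-mono P? Q? xs (P⇒Q ∘ there)

  count-cong : {P Q : A → Set} (P? : Decidable P) (Q? : Decidable Q) (xs : List A) →
               (∀ {x} → x ∈ₗ xs → P x → Q x) → (∀ {x} → x ∈ₗ xs → Q x → P x) →
               count P? xs ≡ count Q? xs
  count-cong P? Q? xs P⇒Q Q⇒P = ≤-antisym (count-mono P? Q? xs P⇒Q) (count-mono Q? P? xs Q⇒P)

  count-mono-tight : {P Q : A → Set} (P? : Decidable P) (Q? : Decidable Q) (xs : List A) →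
                     (∀ {x} → x ∈ₗ xs → P x → Q x) → count Q? xs ≤ count P? xs →
                     ∀ {x} → x ∈ₗ xs → Q x → P x
  count-mono-tight P? Q? (y ∷ xs) P⇒Q Q≤P x∈ qx with P? y | Q? y
  ... | yes p | no ¬q = ⊥-elim (¬q (P⇒Q (here refl) p))
  ... | no ¬p | yes q = ⊥-elim (<⇒≱ (s≤s (count-mono P? Q? xs (P⇒Q ∘ there))) Q≤P)
  count-mono-tight P? Q? (y ∷ xs) P⇒Q Q≤P (here refl) qx | yes p | yes q = p
  count-mono-tight P? Q? (y ∷ xs) P⇒Q Q≤P (there x∈) qx | yes p | yes q =
    count-mono-tight P? Q? xs (P⇒Q ∘ there) (≤-pred Q≤P) x∈ qx
  count-mono-tight P? Q? (y ∷ xs) P⇒Q Q≤P (here refl) qx | no ¬p | no ¬q = ⊥-elim (¬q qx)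
  count-mono-tight P? Q? (y ∷ xs) P⇒Q Q≤P (there x∈) qx | no ¬p | no ¬q =
    count-mono-tight P? Q? xs (P⇒Q ∘ there) Q≤P x∈ qx

  count-none : {P : A → Set} (P? : Decidable P) (xs : List A) →
               (∀ {x} → x ∈ₗ xs → ¬ P x) → count P? xs ≡ 0
  count-none P? [] ¬P = refl
  count-none P? (x ∷ xs) ¬P with P? x
  ... | yes p = ⊥-elim (¬P (here refl) p)
  ... | no _ = count-none P? xs (¬P ∘ there)

  count-all : {P : A → Set} (P? : Decidable P) (xs : List A) →
              (∀ {x} → x ∈ₗ xs → P x) → count P? xs ≡ length xs
  count-all P? [] P-all = refl
  count-all P? (x ∷ xs) P-all with P? x
  ... | yes _ = cong suc (count-all P? xs (P-all ∘ there))
  ... | no ¬p = ⊥-elim (¬p (P-all (here refl)))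

  count-replicate : {P : A → Set} (P? : Decidable P) (s : ℕ) (x : A) →
                    count P? (replicate s x) ≡ s * indicator (P? x)
  count-replicate P? zero x = refl
  count-replicate P? (suc s) x =
    trans (count-∷ P? x (replicate s x)) (cong (indicator (P? x) +_) (count-replicate P? s x))

  count-concatMap-replicate : {P : A → Set} (P? : Decidable P) (s : ℕ) (xs : List A) →
                              count P? (concatMap (replicate s) xs) ≡ s * count P? xs
  count-concatMap-replicate P? s [] = sym (*-zeroʳ s)
  count-concatMap-replicate P? s (x ∷ xs) = begin
    count P? (replicate s x ++ concatMap (replicate s) xs)
      ≡⟨ count-++ P? (replicate s x) _ ⟩
    count P? (replicate s x) + count P? (concatMap (replicate s) xs)
      ≡⟨ cong₂ _+_ (count-replicate P? s x) (count-concatMap-replicate P? s xs) ⟩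
    s * indicator (P? x) + s * count P? xs
      ≡⟨ sym (*-distribˡ-+ s _ _) ⟩
    s * (indicator (P? x) + count P? xs)
      ≡⟨ cong (s *_) (sym (count-∷ P? x xs)) ⟩
    s * count P? (x ∷ xs) ∎
    where open ≡-Reasoning

  count-≢0⇒∃∈ : {P : A → Set} (P? : Decidable P) (xs : List A) →
                count P? xs ≢ 0 → ∃[ x ] x ∈ₗ xs × P x
  count-≢0⇒∃∈ P? xs count≢0 with filter P? xs in eq
  ... | [] = ⊥-elim (count≢0 refl)
  ... | x ∷ _ = x , ∈-filter⁻ P? (subst (x ∈ₗ_) (sym eq) (here refl))

  module _ (_≟_ : DecidableEquality A) where

    count-≟-self : ∀ y ys → count (_≟ y) (y ∷ ys) ≡ suc (count (_≟ y) ys)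
    count-≟-self y ys with y ≟ y
    ... | yes _ = refl
    ... | no y≢y = ⊥-elim (y≢y refl)

    count-≟-≢0⇒∈ : ∀ {y} ys → count (_≟ y) ys ≢ 0 → y ∈ₗ ys
    count-≟-≢0⇒∈ ys count≢0 with count-≢0⇒∃∈ (_≟ _) ys count≢0
    ... | _ , y∈ , refl = y∈

    count-≟-≡⇒↭ : (xs ys : List A) → (∀ y → count (_≟ y) xs ≡ count (_≟ y) ys) → xs ↭ ys
    count-≟-≡⇒↭ [] [] same = ↭-refl
    count-≟-≡⇒↭ [] (y ∷ ys) same = ⊥-elim (1+n≢0 (trans (sym (count-≟-self y ys)) (sym (same y))))
    count-≟-≡⇒↭ (x ∷ xs) ys same
      with ys₁ , ys₂ , refl ← ∈-∃++ (count-≟-≢0⇒∈ ys λ eq →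
                                1+n≢0 (trans (sym (count-≟-self x xs)) (trans (same x) eq)))
      = ↭-trans (prep x (count-≟-≡⇒↭ xs (ys₁ ++ ys₂) same′)) (↭-sym (shift x ys₁ ys₂))
      where
      same′ : ∀ y → count (_≟ y) xs ≡ count (_≟ y) (ys₁ ++ ys₂)
      same′ y = +-cancelˡ-≡ [x≟y] _ _ (begin
        [x≟y] + count (_≟ y) xs                         ≡⟨ sym (count-∷ (_≟ y) x xs) ⟩
        count (_≟ y) (x ∷ xs)                           ≡⟨ same y ⟩
        count (_≟ y) (ys₁ ++ x ∷ ys₂)                   ≡⟨ count-++ (_≟ y) ys₁ (x ∷ ys₂) ⟩
        count (_≟ y) ys₁ + count (_≟ y) (x ∷ ys₂)       ≡⟨ cong (count (_≟ y) ys₁ +_) (count-∷ (_≟ y) x ys₂) ⟩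
        count (_≟ y) ys₁ + ([x≟y] + count (_≟ y) ys₂)   ≡⟨ x∙yz≈y∙xz (count (_≟ y) ys₁) [x≟y] _ ⟩
        [x≟y] + (count (_≟ y) ys₁ + count (_≟ y) ys₂)   ≡⟨ cong ([x≟y] +_) (sym (count-++ (_≟ y) ys₁ ys₂)) ⟩
        [x≟y] + count (_≟ y) (ys₁ ++ ys₂)               ∎)
        where
        open ≡-Reasoning
        [x≟y] : ℕ
        [x≟y] = indicator (x ≟ y)

module _ {A B : Set} where

  count-map : {P : B → Set} (P? : Decidable P) (f : A → B) (xs : List A) →
              count P? (map f xs) ≡ count (P? ∘ f) xs
  count-map P? f [] = refl
  count-map P? f (x ∷ xs) with P? (f x)
  ... | yes _ = cong suc (count-map P? f xs)
  ... | no _ = count-map P? f xs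

module _ {A : Set} where

  sum-map-+ : (f g : A → ℕ) (xs : List A) →
              sum (map (λ x → f x + g x) xs) ≡ sum (map f xs) + sum (map g xs)
  sum-map-+ f g [] = refl
  sum-map-+ f g (x ∷ xs) =
    trans (cong (f x + g x +_) (sum-map-+ f g xs)) (interchange (f x) (g x) _ _)

  sum-map-cong : (f g : A → ℕ) (xs : List A) → (∀ {x} → x ∈ₗ xs → f x ≡ g x) →
                 sum (map f xs) ≡ sum (map g xs)
  sum-map-cong f g [] f≡g = refl
  sum-map-cong f g (x ∷ xs) f≡g = cong₂ _+_ (f≡g (here refl)) (sum-map-cong f g xs (f≡g ∘ there))

  count-as-sum : {P : A → Set} (P? : Decidable P) (xs : List A) →
                 count P? xs ≡ sum (map (indicator ∘ P?) xs)
  count-as-sum P? [] = refl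
  count-as-sum P? (x ∷ xs) = trans (count-∷ P? x xs) (cong (indicator (P? x) +_) (count-as-sum P? xs))

  sum-map-≤ : (s : ℕ) (f : A → ℕ) (xs : List A) → (∀ x → f x ≤ s) → sum (map f xs) ≤ length xs * s
  sum-map-≤ s f [] f≤s = z≤n
  sum-map-≤ s f (x ∷ xs) f≤s = +-mono-≤ (f≤s x) (sum-map-≤ s f xs f≤s)

  sum-map-≤-tight : (s : ℕ) (f : A → ℕ) (xs : List A) → (∀ x → f x ≤ s) →
                    sum (map f xs) ≡ length xs * s → ∀ {x} → x ∈ₗ xs → f x ≡ s
  sum-map-≤-tight s f (y ∷ ys) f≤s eq (here refl) =
    ≤-antisym (f≤s y) (+-cancelʳ-≤ _ _ _ (≤-trans (≤-reflexive (sym eq)) (+-monoʳ-≤ (f y) (sum-map-≤ s f ys f≤s))))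
  sum-map-≤-tight s f (y ∷ ys) f≤s eq (there x∈) = sum-map-≤-tight s f ys f≤s
    (≤-antisym (sum-map-≤ s f ys f≤s) (+-cancelˡ-≤ _ _ _ (≤-trans (≤-reflexive (sym eq)) (+-monoˡ-≤ _ (f≤s y))))) x∈

  *-sum-map-const : (c N : ℕ) (f : A → ℕ) (xs : List A) → (∀ {x} → x ∈ₗ xs → c * f x ≡ N) →
                    c * sum (map f xs) ≡ length xs * N
  *-sum-map-const c N f [] c*f≡N = *-zeroʳ c
  *-sum-map-const c N f (x ∷ xs) c*f≡N =
    trans (*-distribˡ-+ c (f x) _) (cong₂ _+_ (c*f≡N (here refl)) (*-sum-map-const c N f xs (c*f≡N ∘ there)))

sum-count-swap : {X Y : Set} {R : X → Y → Set} (R? : ∀ x y → Dec (R x y)) (xs : List X) (ys : List Y) →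
                 sum (map (λ x → count (R? x) ys) xs) ≡ sum (map (λ y → count (λ x → R? x y) xs) ys)
sum-count-swap R? [] ys = sym (zeros ys)
  where
  zeros : ∀ ys → sum (map (λ _ → 0) ys) ≡ 0
  zeros [] = refl
  zeros (_ ∷ ys) = zeros ys
sum-count-swap R? (x ∷ xs) ys = begin
  count (R? x) ys + sum (map (λ x → count (R? x) ys) xs)
    ≡⟨ cong₂ _+_ (count-as-sum (R? x) ys) (sum-count-swap R? xs ys) ⟩
  sum (map (λ y → indicator (R? x y)) ys) + sum (map (λ y → count (λ x → R? x y) xs) ys)
    ≡⟨ sym (sum-map-+ _ _ ys) ⟩
  sum (map (λ y → indicator (R? x y) + count (λ x → R? x y) xs) ys)
    ≡⟨ sum-map-cong _ _ ys (λ {y} _ → sym (count-∷ (λ x → R? x y) x xs)) ⟩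
  sum (map (λ y → count (λ x → R? x y) (x ∷ xs)) ys) ∎
  where open ≡-Reasoning

-- Subsets of Fin n

private
  variable
    n m : ℕ
    p q : Subset n
    x y z : Fin n
    π : List (Fin n)

_≟ₛ_ : DecidableEquality (Subset n)
_≟ₛ_ = Vec.≡-dec Bool._≟_

Disjoint : Subset n → Subset n → Set
Disjoint p q = ¬ Nonempty (p ∩ q)

disjoint? : (p q : Subset n) → Dec (Disjoint p q)
disjoint? p q = ¬? (nonempty? (p ∩ q))

Disjoint⇒∉ : Disjoint p q → x ∈ p → x ∉ q
Disjoint⇒∉ p∩q≡∅ x∈p x∈q = p∩q≡∅ (_ , x∈p∩q⁺ (x∈p , x∈q))

∉⇒Disjoint : (∀ {x} → x ∈ p → x ∉ q) → Disjoint p q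
∉⇒Disjoint {p = p} {q} ∉q (x , x∈p∩q) with x∈p∩q⁻ p q x∈p∩q
... | x∈p , x∈q = ∉q x∈p x∈q

Disjoint-sym : Disjoint p q → Disjoint q p
Disjoint-sym p∩q≡∅ = ∉⇒Disjoint (λ x∈q x∈p → Disjoint⇒∉ p∩q≡∅ x∈p x∈q)

x∈p─q⇒x∉q : x ∈ p ─ q → x ∉ q
x∈p─q⇒x∉q {p = inside ∷ p} {outside ∷ q} here ()
x∈p─q⇒x∉q {p = _ ∷ p} {_ ∷ q} (there x∈p─q) (there x∈q) = x∈p─q⇒x∉q x∈p─q x∈q

x∈p-y⇒x≢y : x ∈ p - y → x ≢ y
x∈p-y⇒x≢y {y = y} x∈p-y refl = x∈p─q⇒x∉q x∈p-y (x∈⁅x⁆ y)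

⊆-or-∃∉ : (p q : Subset n) → p ⊆ q ⊎ ∃[ x ] x ∈ p × x ∉ q
⊆-or-∃∉ p q with Fin.any? (λ x → (x ∈? p) ×-dec ¬? (x ∈? q))
... | yes witness = inj₂ witness
... | no ¬witness = inj₁ p⊆q
  where
  p⊆q : p ⊆ q
  p⊆q {x} x∈p with x ∈? q
  ... | yes x∈q = x∈q
  ... | no x∉q = ⊥-elim (¬witness (x , x∈p , x∉q))

x∈p⇒suc∣p-x∣≡∣p∣ : x ∈ p → suc ∣ p - x ∣ ≡ ∣ p ∣
x∈p⇒suc∣p-x∣≡∣p∣ {x = zero} {inside ∷ p} here = cong (suc ∘ ∣_∣) (p─⊥≡p p)
x∈p⇒suc∣p-x∣≡∣p∣ {x = suc x} {inside ∷ p} (there x∈p) = cong suc (x∈p⇒suc∣p-x∣≡∣p∣ x∈p)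
x∈p⇒suc∣p-x∣≡∣p∣ {x = suc x} {outside ∷ p} (there x∈p) = x∈p⇒suc∣p-x∣≡∣p∣ x∈p

∣p∣≢0⇒Nonempty : ∣ p ∣ ≢ 0 → Nonempty p
∣p∣≢0⇒Nonempty {p = []} ∣p∣≢0 = ⊥-elim (∣p∣≢0 refl)
∣p∣≢0⇒Nonempty {p = inside ∷ p} _ = zero , here
∣p∣≢0⇒Nonempty {p = outside ∷ p} ∣p∣≢0 with ∣p∣≢0⇒Nonempty ∣p∣≢0
... | x , x∈p = suc x , there x∈p

Disjoint⇒∣p∪q∣≡∣p∣+∣q∣ : Disjoint p q → ∣ p ∪ q ∣ ≡ ∣ p ∣ + ∣ q ∣
Disjoint⇒∣p∪q∣≡∣p∣+∣q∣ {p = []} {[]} _ = refl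
Disjoint⇒∣p∪q∣≡∣p∣+∣q∣ {p = inside ∷ p} {inside ∷ q} p∩q≡∅ = ⊥-elim (p∩q≡∅ (zero , here))
Disjoint⇒∣p∪q∣≡∣p∣+∣q∣ {p = inside ∷ p} {outside ∷ q} p∩q≡∅ =
  cong suc (Disjoint⇒∣p∪q∣≡∣p∣+∣q∣ (λ (x , x∈) → p∩q≡∅ (suc x , there x∈)))
Disjoint⇒∣p∪q∣≡∣p∣+∣q∣ {p = outside ∷ p} {inside ∷ q} p∩q≡∅ =
  trans (cong suc (Disjoint⇒∣p∪q∣≡∣p∣+∣q∣ (λ (x , x∈) → p∩q≡∅ (suc x , there x∈)))) (sym (+-suc _ _))
Disjoint⇒∣p∪q∣≡∣p∣+∣q∣ {p = outside ∷ p} {outside ∷ q} p∩q≡∅ =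
  Disjoint⇒∣p∪q∣≡∣p∣+∣q∣ (λ (x , x∈) → p∩q≡∅ (suc x , there x∈))

p⊆q∧∣q∣≤∣p∣⇒p≡q : p ⊆ q → ∣ q ∣ ≤ ∣ p ∣ → p ≡ q
p⊆q∧∣q∣≤∣p∣⇒p≡q {p = []} {[]} _ _ = refl
p⊆q∧∣q∣≤∣p∣⇒p≡q {p = inside ∷ p} {inside ∷ q} p⊆q ∣q∣≤∣p∣ =
  cong (inside ∷_) (p⊆q∧∣q∣≤∣p∣⇒p≡q (drop-∷-⊆ p⊆q) (≤-pred ∣q∣≤∣p∣))
p⊆q∧∣q∣≤∣p∣⇒p≡q {p = inside ∷ p} {outside ∷ q} p⊆q _ with p⊆q here
... | ()
p⊆q∧∣q∣≤∣p∣⇒p≡q {p = outside ∷ p} {inside ∷ q} p⊆q ∣q∣≤∣p∣ =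
  ⊥-elim (<⇒≱ (s≤s (p⊆q⇒∣p∣≤∣q∣ (drop-∷-⊆ p⊆q))) ∣q∣≤∣p∣)
p⊆q∧∣q∣≤∣p∣⇒p≡q {p = outside ∷ p} {outside ∷ q} p⊆q ∣q∣≤∣p∣ =
  cong (outside ∷_) (p⊆q∧∣q∣≤∣p∣⇒p≡q (drop-∷-⊆ p⊆q) ∣q∣≤∣p∣)

p⊆q∧∣p∣≡∣q∣⇒p≡q : p ⊆ q → ∣ p ∣ ≡ ∣ q ∣ → p ≡ q
p⊆q∧∣p∣≡∣q∣⇒p≡q p⊆q ∣p∣≡∣q∣ = p⊆q∧∣q∣≤∣p∣⇒p≡q p⊆q (≤-reflexive (sym ∣p∣≡∣q∣))

∣p∣≡∑indicator : (p : Subset n) → ∣ p ∣ ≡ ∑[ i < n ] indicator (i ∈? p)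
∣p∣≡∑indicator [] = refl
∣p∣≡∑indicator (inside ∷ p) = cong suc (∣p∣≡∑indicator p)
∣p∣≡∑indicator (outside ∷ p) = ∣p∣≡∑indicator p

x∉p⇒p-x≡p : x ∉ p → p - x ≡ p
x∉p⇒p-x≡p x∉p = ⊆-antisym (p─q⊆p _ _) (λ y∈p → x∈p∧x≢y⇒x∈p-y y∈p λ { refl → x∉p y∈p })

∑-indicator-* : (p : Subset n) (c : ℕ) → ∑[ x < n ] (indicator (x ∈? p) * c) ≡ ∣ p ∣ * c
∑-indicator-* p c = sym (trans (cong (_* c) (∣p∣≡∑indicator p)) (*-distribʳ-sum c (λ x → indicator (x ∈? p))))

-- On the empty subset the value 0 is junk.
minOn : (Fin n → ℕ) → Subset n → ℕ
minOn f [] = 0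
minOn f (outside ∷ p) = minOn (f ∘ suc) p
minOn f (inside ∷ p) with nonempty? p
... | yes _ = f zero ⊓ minOn (f ∘ suc) p
... | no _ = f zero

minOn-≤ : (f : Fin n → ℕ) → x ∈ p → minOn f p ≤ f x
minOn-≤ {p = outside ∷ p} f (there x∈p) = minOn-≤ (f ∘ suc) x∈p
minOn-≤ {p = inside ∷ p} f x∈ with nonempty? p | x∈
... | yes _ | here = m⊓n≤m _ _
... | yes _ | there x∈p = ≤-trans (m⊓n≤n _ _) (minOn-≤ (f ∘ suc) x∈p)
... | no _ | here = ≤-refl
... | no p≡∅ | there x∈p = ⊥-elim (p≡∅ (_ , x∈p))

minOn-attained : (f : Fin n → ℕ) → Nonempty p → ∃[ x ] x ∈ p × f x ≡ minOn f p
minOn-attained {p = outside ∷ p} f (suc x , there x∈p) with minOn-attained (f ∘ suc) (x , x∈p)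
... | y , y∈p , fy≡min = suc y , there y∈p , fy≡min
minOn-attained {p = inside ∷ p} f _ with nonempty? p
... | no _ = zero , here , refl
... | yes p≢∅ with ⊓-sel (f zero) (minOn (f ∘ suc) p)
...   | inj₁ min≡f0 = zero , here , sym min≡f0
...   | inj₂ min≡rest with minOn-attained (f ∘ suc) p≢∅
...     | y , y∈p , fy≡min = suc y , there y∈p , trans fy≡min (sym min≡rest)

minOn-≤-minOn : (f : Fin n → ℕ) → Nonempty q → ∃[ x ] x ∈ p × (∀ {y} → y ∈ q → f x ≤ f y) →
                minOn f p ≤ minOn f q
minOn-≤-minOn f q≢∅ (x , x∈p , fx≤q) with y , y∈q , fy≡min ← minOn-attained f q≢∅ =
  ≤-trans (minOn-≤ f x∈p) (subst (f x ≤_) fy≡min (fx≤q y∈q))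

replace : Subset n → Fin n → Fin n → Subset n
replace p x y = (p - x) ∪ ⁅ y ⁆

∈-replace⁺ˡ : x ∈ p → x ≢ y → x ∈ replace p y z
∈-replace⁺ˡ x∈p x≢y = x∈p∪q⁺ (inj₁ (x∈p∧x≢y⇒x∈p-y x∈p x≢y))

∈-replace⁺ʳ : z ∈ replace p y z
∈-replace⁺ʳ {z = z} = x∈p∪q⁺ (inj₂ (x∈⁅x⁆ z))

∈-replace⁻ : x ∈ replace p y z → (x ∈ p × x ≢ y) ⊎ x ≡ z
∈-replace⁻ {p = p} {y = y} {z = z} x∈ with x∈p∪q⁻ (p - y) ⁅ z ⁆ x∈
... | inj₁ x∈p-y = inj₁ (p─q⊆p _ _ x∈p-y , x∈p-y⇒x≢y x∈p-y)
... | inj₂ x∈⁅z⁆ = inj₂ (x∈⁅y⁆⇒x≡y z x∈⁅z⁆)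

∣replace∣≡∣p∣ : x ∈ p → y ∉ p → ∣ replace p x y ∣ ≡ ∣ p ∣
∣replace∣≡∣p∣ {x = x} {p = p} {y = y} x∈p y∉p = begin
  ∣ (p - x) ∪ ⁅ y ⁆ ∣     ≡⟨ Disjoint⇒∣p∪q∣≡∣p∣+∣q∣ {p = p - x} {q = ⁅ y ⁆} (∉⇒Disjoint λ z∈p-x z∈⁅y⁆ →
                                y∉p (subst (_∈ p) (x∈⁅y⁆⇒x≡y y z∈⁅y⁆) (p─q⊆p _ _ z∈p-x))) ⟩
  ∣ p - x ∣ + ∣ ⁅ y ⁆ ∣   ≡⟨ cong (∣ p - x ∣ +_) (∣⁅x⁆∣≡1 y) ⟩
  ∣ p - x ∣ + 1           ≡⟨ +-comm _ 1 ⟩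
  suc ∣ p - x ∣           ≡⟨ x∈p⇒suc∣p-x∣≡∣p∣ x∈p ⟩
  ∣ p ∣                   ∎
  where open ≡-Reasoning

Disjoint-─ : (p q : Subset n) → Disjoint p (q ─ p)
Disjoint-─ p q = ∉⇒Disjoint λ x∈p x∈q─p → x∈p─q⇒x∉q x∈q─p x∈p

─-replace : ∀ {r} → x ∈ p → p ⊆ r → y ∈ r ─ p → r ─ replace p x y ≡ replace (r ─ p) y x
─-replace {x = x} {p = p} {y = y} {r} x∈p p⊆r y∈r─p = ⊆-antisym to from
  where
  y∉p : y ∉ p
  y∉p = x∈p─q⇒x∉q y∈r─p
  to : r ─ replace p x y ⊆ replace (r ─ p) y x
  to {z} z∈ with z Fin.≟ x
  ... | yes refl = ∈-replace⁺ʳ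
  ... | no z≢x = ∈-replace⁺ˡ (x∈p∧x∉q⇒x∈p─q (p─q⊆p _ _ z∈) λ z∈p → x∈p─q⇒x∉q z∈ (∈-replace⁺ˡ z∈p z≢x))
                             λ { refl → x∈p─q⇒x∉q z∈ ∈-replace⁺ʳ }
  from : replace (r ─ p) y x ⊆ r ─ replace p x y
  from {z} z∈ with ∈-replace⁻ z∈
  ... | inj₁ (z∈r─p , z≢y) = x∈p∧x∉q⇒x∈p─q (p─q⊆p _ _ z∈r─p) λ z∈p′ → case ∈-replace⁻ z∈p′ of λ where
          (inj₁ (z∈p , _)) → x∈p─q⇒x∉q z∈r─p z∈p
          (inj₂ z≡y) → z≢y z≡y
  ... | inj₂ refl = x∈p∧x∉q⇒x∈p─q (p⊆r x∈p) λ x∈p′ → case ∈-replace⁻ x∈p′ of λ where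
          (inj₁ (_ , x≢x)) → x≢x refl
          (inj₂ refl) → y∉p x∈p


-- Orderings

Ordering : ℕ → Set
Ordering n = List (Fin n)

position : Ordering n → Fin n → ℕ
position [] y = 0
position (x ∷ π) y = if does (x Fin.≟ y) then 0 else suc (position π y)

position-head : (x : Fin n) (π : Ordering n) → position (x ∷ π) x ≡ 0
position-head x π with x Fin.≟ x
... | yes _ = refl
... | no x≢x = ⊥-elim (x≢x refl)

position-tail : (π : Ordering n) {y : Fin n} → x ≢ y → position (x ∷ π) y ≡ suc (position π y)
position-tail {x = x} π {y} x≢y with x Fin.≟ y
... | yes x≡y = ⊥-elim (x≢y x≡y)
... | no _ = refl

Precedes : Subset n → Subset n → Ordering n → Set
Precedes A B π = ∀ {a b} → a ∈ A → b ∈ B → position π a < position π b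

precedes? : (A B : Subset n) → Decidable (Precedes A B)
precedes? A B π with Fin.all? (λ a → Fin.all? (λ b → (a ∈? A) →-dec (b ∈? B) →-dec (position π a <? position π b)))
... | yes ok = yes λ {a} {b} a∈A b∈B → ok a b a∈A b∈B
... | no ¬ok = no λ prec → ¬ok λ a b a∈A b∈B → prec a∈A b∈B

Empty⇒Precedes : ∀ {A B : Subset n} → Empty A → Precedes A B π
Empty⇒Precedes A≡∅ a∈A _ = ⊥-elim (A≡∅ (_ , a∈A))

∈B⇒¬Precedes-∷ : ∀ {A B : Subset n} → x ∈ B → Nonempty A → ¬ Precedes A B (x ∷ π)
∈B⇒¬Precedes-∷ {x = x} {π = π} x∈B (a , a∈A) prec =
  <⇒≱ (prec a∈A x∈B) (subst (_≤ position (x ∷ π) a) (sym (position-head x π)) z≤n)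

module _ {B : Subset n} {x : Fin n} (x∉B : x ∉ B) where

  private
    ≢x : ∀ {b} → b ∈ B → x ≢ b
    ≢x b∈B refl = x∉B b∈B

  Precedes-∷⁻ : ∀ {A} → Precedes A B (x ∷ π) → Precedes (A - x) B π
  Precedes-∷⁻ {π = π} prec {a} a∈A-x b∈B =
    ≤-pred (subst₂ _<_ (position-tail π (x∈p-y⇒x≢y a∈A-x ∘ sym)) (position-tail π (≢x b∈B))
      (prec (p─q⊆p _ _ a∈A-x) b∈B))

  Precedes-∷⁺ : ∀ {A} → Precedes (A - x) B π → Precedes A B (x ∷ π)
  Precedes-∷⁺ {π = π} prec {a} a∈A b∈B
    rewrite position-tail π (≢x b∈B) with x Fin.≟ a
  ... | yes _ = s≤s z≤n
  ... | no x≢a = s≤s (prec (x∈p∧x≢y⇒x∈p-y a∈A (x≢a ∘ sym)) b∈B)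

module _ {A : Set} where

  count-concat-tabulate : {P : A → Set} (P? : Decidable P) (g : Fin n → List A) →
                          count P? (concat (tabulate g)) ≡ ∑[ i < n ] count P? (g i)
  count-concat-tabulate {n = zero} P? g = refl
  count-concat-tabulate {n = suc n} P? g =
    trans (count-++ P? (g zero) _) (cong (count P? (g zero) +_) (count-concat-tabulate P? (g ∘ suc)))

  length-concat-tabulate : (g : Fin n → List A) → length (concat (tabulate g)) ≡ ∑[ i < n ] length (g i)
  length-concat-tabulate {n = zero} g = refl
  length-concat-tabulate {n = suc n} g =
    trans (length-++ (g zero)) (cong (length (g zero) +_) (length-concat-tabulate (g ∘ suc)))

∈-concat-tabulate : {A : Set} (g : Fin n → List A) (i : Fin n) {y : A} → y ∈ₗ g i → y ∈ₗ concat (tabulate g)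
∈-concat-tabulate g zero y∈ = ∈-++⁺ˡ y∈
∈-concat-tabulate g (suc i) y∈ = ∈-++⁺ʳ (g zero) (∈-concat-tabulate (g ∘ suc) i y∈)

-- The repetition-free lists enumerating X, provided ∣ X ∣ ≡ m.
orderings : ℕ → Subset n → List (Ordering n)
orderings zero X = [] ∷ []
orderings (suc m) X = concat (tabulate λ x → if does (x ∈? X) then map (x ∷_) (orderings m (X - x)) else [])

length-orderings : ∀ m (X : Subset n) → ∣ X ∣ ≡ m → length (orderings m X) ≡ m !
length-orderings zero X _ = refl
length-orderings {n} (suc m) X ∣X∣≡1+m = begin
  length (orderings (suc m) X)            ≡⟨ length-concat-tabulate branch ⟩
  ∑[ x < n ] length (branch x)             ≡⟨ sum-cong-≗ length-branch ⟩
  ∑[ x < n ] (indicator (x ∈? X) * m !)    ≡⟨ ∑-indicator-* X (m !) ⟩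
  ∣ X ∣ * m !                              ≡⟨ cong (_* m !) ∣X∣≡1+m ⟩
  suc m * m ! ∎
  where
  open ≡-Reasoning
  branch : Fin n → List (Ordering n)
  branch x = if does (x ∈? X) then map (x ∷_) (orderings m (X - x)) else []
  length-branch : ∀ x → length (branch x) ≡ indicator (x ∈? X) * m !
  length-branch x with x ∈? X
  ... | yes x∈X = trans (length-map (x ∷_) (orderings m (X - x)))
                   (trans (length-orderings m (X - x) (suc-injective (trans (x∈p⇒suc∣p-x∣≡∣p∣ x∈X) ∣X∣≡1+m)))
                          (sym (+-identityʳ _)))
  ... | no _ = refl

count-∷-precedes : ∀ {A B : Subset n} {x : Fin n} → x ∉ B → (πs : List (Ordering n)) →
                   count (precedes? A B) (map (x ∷_) πs) ≡ count (precedes? (A - x) B) πs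
count-∷-precedes {A = A} {B} {x} x∉B πs =
  trans (count-map (precedes? A B) (x ∷_) πs)
        (count-cong _ _ πs (λ {π} _ → Precedes-∷⁻ x∉B {π = π}) (λ {π} _ → Precedes-∷⁺ x∉B {π = π}))

count-∷-precedes-∈ : ∀ {A B : Subset n} {x : Fin n} → x ∈ B → Nonempty A → (πs : List (Ordering n)) →
                     count (precedes? A B) (map (x ∷_) πs) ≡ 0
count-∷-precedes-∈ {A = A} {B} {x} x∈B A≢∅ πs =
  trans (count-map (precedes? A B) (x ∷_) πs) (count-none _ πs (λ {π} _ → ∈B⇒¬Precedes-∷ {π = π} x∈B A≢∅))

private
  factorial-step : ∀ a b m c → (a + b) ! * c ≡ m ! * (a ! * b !) →
                   suc a * ((suc a + b) ! * c) ≡ (suc a + b) * (m ! * (suc a ! * b !))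
  factorial-step a b m c formula = begin
    suc a * ((suc (a + b) * (a + b) !) * c)      ≡⟨ exchange (suc a) (suc (a + b)) ((a + b) !) c ⟩
    suc (a + b) * (suc a * ((a + b) ! * c))      ≡⟨ cong (λ t → suc (a + b) * (suc a * t)) formula ⟩
    suc (a + b) * (suc a * (m ! * (a ! * b !)))  ≡⟨ cong (suc (a + b) *_) (absorb (suc a) (m !) (a !) (b !)) ⟩
    suc (a + b) * (m ! * ((suc a * a !) * b !))  ∎
    where
    open ≡-Reasoning
    exchange : ∀ x y z w → x * ((y * z) * w) ≡ y * (x * (z * w))
    exchange = solve-∀
    absorb : ∀ x y z w → x * (y * (z * w)) ≡ y * ((x * z) * w)
    absorb = solve-∀

count-precedes-empty : ∀ m (X A B : Subset n) → ∣ X ∣ ≡ m → Empty A →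
                       (∣ A ∣ + ∣ B ∣) ! * count (precedes? A B) (orderings m X) ≡ m ! * (∣ A ∣ ! * ∣ B ∣ !)
count-precedes-empty {n} m X A B ∣X∣≡m A≡∅ = begin
  (∣ A ∣ + ∣ B ∣) ! * count (precedes? A B) (orderings m X)
    ≡⟨ cong₂ (λ a c → (a + ∣ B ∣) ! * c) ∣A∣≡0
             (count-all _ (orderings m X) (λ {π} _ → Empty⇒Precedes {π = π} A≡∅)) ⟩
  ∣ B ∣ ! * length (orderings m X)   ≡⟨ cong (∣ B ∣ ! *_) (length-orderings m X ∣X∣≡m) ⟩
  ∣ B ∣ ! * m !                      ≡⟨ *-comm (∣ B ∣ !) (m !) ⟩
  m ! * ∣ B ∣ !                      ≡⟨ cong (m ! *_) (sym (+-identityʳ _)) ⟩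
  m ! * (0 ! * ∣ B ∣ !)              ≡⟨ cong (λ a → m ! * (a ! * ∣ B ∣ !)) (sym ∣A∣≡0) ⟩
  m ! * (∣ A ∣ ! * ∣ B ∣ !)          ∎
  where
  open ≡-Reasoning
  ∣A∣≡0 : ∣ A ∣ ≡ 0
  ∣A∣≡0 = trans (cong ∣_∣ (Empty-unique A≡∅)) (∣⊥∣≡0 n)

-- The inductive step of count-precedes: an ordering of X starts with some x ∉ B, and the rest is an
-- ordering of X - x with A - x before B. The identity is multiplied by ∣ A ∣ to keep it division-free.
module _ {m} {X A B : Subset n} (∣X∣≡1+m : ∣ X ∣ ≡ suc m) (A⊆X : A ⊆ X) (B⊆X : B ⊆ X)
         (A∩B≡∅ : Disjoint A B) (A≢∅ : Nonempty A)
         (recursive : ∀ {x} → x ∈ X → x ∉ B →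
                      (∣ A - x ∣ + ∣ B ∣) ! * count (precedes? (A - x) B) (orderings m (X - x))
                        ≡ m ! * (∣ A - x ∣ ! * ∣ B ∣ !))
         where

  private
    a b β Q : ℕ
    a = ∣ A ∣
    b = ∣ B ∣
    β = m ! * (a ! * b !)
    Q = a * β

    branch : Fin n → List (Ordering n)
    branch x = if does (x ∈? X) then map (x ∷_) (orderings m (X - x)) else []

    c : Fin n → ℕ
    c x = count (precedes? A B) (branch x)

    outside-X : ∀ a P Q → a * 0 + 0 * Q + 0 * Q ≡ 0 * P + 0 * Q
    outside-X = solve-∀
    in-B : ∀ a P Q → a * 0 + 1 * Q + 0 * Q ≡ 0 * P + 1 * Q
    in-B = solve-∀
    in-A : ∀ P Q → P + 0 * Q + 1 * Q ≡ 1 * P + 1 * Q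
    in-A = solve-∀
    in-X : ∀ a β P → a * β + 0 * (a * β) + 0 * (a * β) ≡ 0 * P + 1 * (a * β)
    in-X = solve-∀

    branch-in-A : ∀ {x} → x ∈ X → x ∈ A → x ∉ B →
                  a * ((a + b) ! * count (precedes? A B) (map (x ∷_) (orderings m (X - x)))) ≡ (a + b) * β
    branch-in-A {x} x∈X x∈A x∉B =
      subst (λ a → a * ((a + b) ! * N) ≡ (a + b) * (m ! * (a ! * b !))) (x∈p⇒suc∣p-x∣≡∣p∣ x∈A)
        (factorial-step ∣ A - x ∣ b m N
          (trans (cong ((∣ A - x ∣ + b) ! *_) (count-∷-precedes x∉B (orderings m (X - x)))) (recursive x∈X x∉B)))
      where
      N : ℕ
      N = count (precedes? A B) (map (x ∷_) (orderings m (X - x)))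

    branch-outside-A : ∀ {x} → x ∈ X → x ∉ A → x ∉ B →
                       (a + b) ! * count (precedes? A B) (map (x ∷_) (orderings m (X - x))) ≡ β
    branch-outside-A {x} x∈X x∉A x∉B =
      trans (cong ((a + b) ! *_) (count-∷-precedes x∉B (orderings m (X - x))))
            (subst (λ k → (k + b) ! * count (precedes? (A - x) B) (orderings m (X - x)) ≡ m ! * (k ! * b !))
                   (cong ∣_∣ (x∉p⇒p-x≡p x∉A)) (recursive x∈X x∉B))

    pointwise : ∀ x → a * ((a + b) ! * c x) + indicator (x ∈? B) * Q + indicator (x ∈? A) * Q
                      ≡ indicator (x ∈? A) * ((a + b) * β) + indicator (x ∈? X) * Q
    pointwise x with x ∈? X | x ∈? A | x ∈? B
    ... | _ | yes x∈A | yes x∈B = ⊥-elim (Disjoint⇒∉ A∩B≡∅ x∈A x∈B)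
    ... | no x∉X | yes x∈A | _ = ⊥-elim (x∉X (A⊆X x∈A))
    ... | no x∉X | _ | yes x∈B = ⊥-elim (x∉X (B⊆X x∈B))
    ... | no _ | no _ | no _ =
      trans (cong (λ t → a * t + 0 * Q + 0 * Q) (*-zeroʳ ((a + b) !))) (outside-X a ((a + b) * β) Q)
    ... | yes _ | no _ | yes x∈B =
      trans (cong (λ t → a * ((a + b) ! * t) + 1 * Q + 0 * Q) (count-∷-precedes-∈ x∈B A≢∅ (orderings m (X - x))))
            (trans (cong (λ t → a * t + 1 * Q + 0 * Q) (*-zeroʳ ((a + b) !))) (in-B a ((a + b) * β) Q))
    ... | yes x∈X | yes x∈A | no x∉B =
      trans (cong (λ t → t + 0 * Q + 1 * Q) (branch-in-A x∈X x∈A x∉B)) (in-A ((a + b) * β) Q)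
    ... | yes x∈X | no x∉A | no x∉B =
      trans (cong (λ t → a * t + 0 * Q + 0 * Q) (branch-outside-A x∈X x∉A x∉B)) (in-X a β ((a + b) * β))

    summed : a * ((a + b) ! * ∑[ x < n ] c x) + (b * Q + a * Q) ≡ suc m * Q + (b * Q + a * Q)
    summed = begin
      a * ((a + b) ! * ∑[ x < n ] c x) + (b * Q + a * Q)
        ≡⟨ sym (+-assoc _ (b * Q) (a * Q)) ⟩
      a * ((a + b) ! * ∑[ x < n ] c x) + b * Q + a * Q
        ≡⟨ sym (trans (∑-distrib-+ (λ x → term x + indicator (x ∈? B) * Q) (λ x → indicator (x ∈? A) * Q))
                      (cong₂ _+_ (trans (∑-distrib-+ term (λ x → indicator (x ∈? B) * Q))
                                        (cong₂ _+_ ∑-terms (∑-indicator-* B Q)))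
                                 (∑-indicator-* A Q))) ⟩
      ∑[ x < n ] (term x + indicator (x ∈? B) * Q + indicator (x ∈? A) * Q)
        ≡⟨ sum-cong-≗ pointwise ⟩
      ∑[ x < n ] (indicator (x ∈? A) * ((a + b) * β) + indicator (x ∈? X) * Q)
        ≡⟨ trans (∑-distrib-+ (λ x → indicator (x ∈? A) * ((a + b) * β)) (λ x → indicator (x ∈? X) * Q))
                 (cong₂ _+_ (∑-indicator-* A _) (∑-indicator-* X Q)) ⟩
      a * ((a + b) * β) + ∣ X ∣ * Q
        ≡⟨ cong₂ _+_ (split a b β) (cong (_* Q) ∣X∣≡1+m) ⟩
      b * Q + a * Q + suc m * Q
        ≡⟨ +-comm (b * Q + a * Q) _ ⟩
      suc m * Q + (b * Q + a * Q) ∎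
      where
      open ≡-Reasoning
      term : Fin n → ℕ
      term x = a * ((a + b) ! * c x)
      ∑-terms : ∑[ x < n ] term x ≡ a * ((a + b) ! * ∑[ x < n ] c x)
      ∑-terms = trans (sym (*-distribˡ-sum a (λ x → (a + b) ! * c x))) (cong (a *_) (sym (*-distribˡ-sum ((a + b) !) c)))
      split : ∀ a b β → a * ((a + b) * β) ≡ b * (a * β) + a * (a * β)
      split = solve-∀

    rearrange : ∀ a k f r → k * (a * (f * r)) ≡ a * ((k * f) * r)
    rearrange = solve-∀

  count-precedes-suc : (a + b) ! * count (precedes? A B) (orderings (suc m) X) ≡ suc m ! * (a ! * b !)
  count-precedes-suc = *-cancelˡ-≡ _ _ a {{≢-nonZero ∣A∣≢0}} (begin
    a * ((a + b) ! * count (precedes? A B) (orderings (suc m) X))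
      ≡⟨ cong (λ t → a * ((a + b) ! * t)) (count-concat-tabulate (precedes? A B) branch) ⟩
    a * ((a + b) ! * ∑[ x < n ] c x)  ≡⟨ +-cancelʳ-≡ (b * Q + a * Q) _ _ summed ⟩
    suc m * Q                         ≡⟨ rearrange a (suc m) (m !) (a ! * b !) ⟩
    a * (suc m ! * (a ! * b !))       ∎)
    where
    open ≡-Reasoning
    ∣A∣≢0 : a ≢ 0
    ∣A∣≢0 a≡0 = 1+n≢0 (trans (x∈p⇒suc∣p-x∣≡∣p∣ (proj₂ A≢∅)) a≡0)

count-precedes : ∀ m (X A B : Subset n) → ∣ X ∣ ≡ m → A ⊆ X → B ⊆ X → Disjoint A B →
                 (∣ A ∣ + ∣ B ∣) ! * count (precedes? A B) (orderings m X) ≡ m ! * (∣ A ∣ ! * ∣ B ∣ !)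
count-precedes m X A B ∣X∣≡m A⊆X B⊆X A∩B≡∅ with nonempty? A
... | no A≡∅ = count-precedes-empty m X A B ∣X∣≡m A≡∅
count-precedes zero X A B ∣X∣≡0 A⊆X _ _ | yes (a , a∈A) =
  ⊥-elim (1+n≢0 (trans (x∈p⇒suc∣p-x∣≡∣p∣ (A⊆X a∈A)) ∣X∣≡0))
count-precedes (suc m) X A B ∣X∣≡1+m A⊆X B⊆X A∩B≡∅ | yes A≢∅ =
  count-precedes-suc ∣X∣≡1+m A⊆X B⊆X A∩B≡∅ A≢∅ λ {x} x∈X x∉B → count-precedes m (X - x) (A - x) B
    (suc-injective (trans (x∈p⇒suc∣p-x∣≡∣p∣ x∈X) ∣X∣≡1+m))
    (λ y∈A-x → x∈p∧x≢y⇒x∈p-y (A⊆X (p─q⊆p _ _ y∈A-x)) (x∈p-y⇒x≢y y∈A-x))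
    (λ {y} y∈B → x∈p∧x≢y⇒x∈p-y (B⊆X y∈B) λ { refl → x∉B y∈B })
    (∉⇒Disjoint λ y∈A-x → Disjoint⇒∉ A∩B≡∅ (p─q⊆p _ _ y∈A-x))

orderings-refine : (r : Fin n → ℕ) → ∀ m (X : Subset n) → ∣ X ∣ ≡ m →
                   ∃[ π ] π ∈ₗ orderings m X × (∀ {y z} → y ∈ X → z ∈ X → r y < r z → position π y < position π z)
orderings-refine r zero X ∣X∣≡0 =
  [] , here refl , λ y∈X _ _ → ⊥-elim (1+n≢0 (trans (x∈p⇒suc∣p-x∣≡∣p∣ y∈X) ∣X∣≡0))
orderings-refine r (suc m) X ∣X∣≡1+m
  with x , x∈X , rx≡min ← minOn-attained r (∣p∣≢0⇒Nonempty (subst (_≢ 0) (sym ∣X∣≡1+m) 1+n≢0))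
  with π , π∈ , respects ← orderings-refine r m (X - x) (suc-injective (trans (x∈p⇒suc∣p-x∣≡∣p∣ x∈X) ∣X∣≡1+m))
  = x ∷ π , x∷π∈ , respects′
  where
  x∷π∈ : x ∷ π ∈ₗ orderings (suc m) X
  x∷π∈ = ∈-concat-tabulate _ x (subst (x ∷ π ∈ₗ_) (sym (if-yes (x ∈? X) x∈X)) (∈-map⁺ (x ∷_) π∈))
    where
    if-yes : ∀ {P : Set} {L : List (Ordering n)} (P? : Dec P) → P → (if does P? then L else []) ≡ L
    if-yes (yes _) _ = refl
    if-yes (no ¬p) p = ⊥-elim (¬p p)
  respects′ : ∀ {y z} → y ∈ X → z ∈ X → r y < r z → position (x ∷ π) y < position (x ∷ π) z
  respects′ {y} {z} y∈X z∈X ry<rz with x Fin.≟ z | x Fin.≟ y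
  ... | yes refl | _ = ⊥-elim (<⇒≱ ry<rz (subst (_≤ r y) (sym rx≡min) (minOn-≤ r y∈X)))
  ... | no x≢z | yes refl = s≤s z≤n
  ... | no x≢z | no x≢y =
    s≤s (respects (x∈p∧x≢y⇒x∈p-y y∈X (x≢y ∘ sym)) (x∈p∧x≢y⇒x∈p-y z∈X (x≢z ∘ sym)) ry<rz)


-- Enumerating a subset

image-≡ : (f : Fin m → Fin n) {Z : Subset m} {W : Subset n} →
          (∀ {i} → i ∈ Z → f i ∈ W) → (∀ {j} → j ∈ W → ∃[ i ] i ∈ Z × f i ≡ j) → image f Z ≡ W
image-≡ f {Z} {W} ⊆W W⊆ = trans (Vec.tabulate-cong pointwise) (Vec.tabulate∘lookup W)
  where
  pointwise : ∀ j → does (Fin.any? (λ i → (i ∈? Z) ×-dec (f i Fin.≟ j))) ≡ lookup W j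
  pointwise j with Fin.any? (λ i → (i ∈? Z) ×-dec (f i Fin.≟ j)) | lookup W j in W[j]
  ... | yes _ | inside = refl
  ... | yes (i , i∈Z , refl) | outside with () ← trans (sym (Vec.[]=⇒lookup (⊆W i∈Z))) W[j]
  ... | no _ | outside = refl
  ... | no none | inside = ⊥-elim (none (W⊆ (Vec.lookup⇒[]= j W W[j])))

enumerate : ∀ {n} (X : Subset n) {m} → ∣ X ∣ ≡ m → Fin m → Fin n
enumerate [] {zero} e ()
enumerate (outside ∷ X) e i = suc (enumerate X e i)
enumerate (inside ∷ X) {zero} () _
enumerate (inside ∷ X) {suc m} e zero = zero
enumerate (inside ∷ X) {suc m} e (suc i) = suc (enumerate X (suc-injective e) i)

embed : ∀ {n} (X : Subset n) {m} → ∣ X ∣ ≡ m → Subset m → Subset n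
embed [] e Z = []
embed (inside ∷ X) {zero} () Z
embed (inside ∷ X) {suc m} e (z ∷ Z) = z ∷ embed X (suc-injective e) Z
embed (outside ∷ X) e Z = outside ∷ embed X e Z

restrict : ∀ {n} (X : Subset n) {m} → ∣ X ∣ ≡ m → Subset n → Subset m
restrict [] {zero} e Y = []
restrict (inside ∷ X) {zero} () Y
restrict (inside ∷ X) {suc m} e (y ∷ Y) = y ∷ restrict X (suc-injective e) Y
restrict (outside ∷ X) e (_ ∷ Y) = restrict X e Y

enumerate-injective : ∀ {n} (X : Subset n) {m} (e : ∣ X ∣ ≡ m) → Injective _≡_ _≡_ (enumerate X e)
enumerate-injective (inside ∷ X) {zero} ()
enumerate-injective (inside ∷ X) {suc m} e {zero} {zero} _ = refl
enumerate-injective (inside ∷ X) {suc m} e {suc i} {suc j} eq =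
  cong suc (enumerate-injective X (suc-injective e) (Fin.suc-injective eq))
enumerate-injective (outside ∷ X) e eq = enumerate-injective X e (Fin.suc-injective eq)

enumerate-∈-embed : ∀ {n} (X : Subset n) {m} (e : ∣ X ∣ ≡ m) {Z : Subset m} {i : Fin m} →
                    i ∈ Z → enumerate X e i ∈ embed X e Z
enumerate-∈-embed (inside ∷ X) {zero} () _
enumerate-∈-embed (inside ∷ X) {suc m} e {_ ∷ Z} {zero} here = here
enumerate-∈-embed (inside ∷ X) {suc m} e {_ ∷ Z} {suc i} (there i∈Z) = there (enumerate-∈-embed X (suc-injective e) i∈Z)
enumerate-∈-embed (outside ∷ X) e i∈Z = there (enumerate-∈-embed X e i∈Z)

∈-embed⁻ : ∀ {n} (X : Subset n) {m} (e : ∣ X ∣ ≡ m) {Z : Subset m} {j : Fin n} →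
           j ∈ embed X e Z → ∃[ i ] i ∈ Z × enumerate X e i ≡ j
∈-embed⁻ (inside ∷ X) {zero} () _
∈-embed⁻ (inside ∷ X) {suc m} e {_ ∷ Z} {zero} here = zero , here , refl
∈-embed⁻ (inside ∷ X) {suc m} e {_ ∷ Z} {suc j} (there j∈) with i , i∈Z , refl ← ∈-embed⁻ X (suc-injective e) j∈ =
  suc i , there i∈Z , refl
∈-embed⁻ (outside ∷ X) e {Z} {suc j} (there j∈) with i , i∈Z , refl ← ∈-embed⁻ X e j∈ = i , i∈Z , refl

image-enumerate : ∀ {n} (X : Subset n) {m} (e : ∣ X ∣ ≡ m) (Z : Subset m) → image (enumerate X e) Z ≡ embed X e Z
image-enumerate X e Z = image-≡ (enumerate X e) (enumerate-∈-embed X e) (∈-embed⁻ X e)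

embed⊆ : ∀ {n} (X : Subset n) {m} (e : ∣ X ∣ ≡ m) (Z : Subset m) → embed X e Z ⊆ X
embed⊆ (inside ∷ X) {zero} () _
embed⊆ (inside ∷ X) {suc m} e (_ ∷ Z) here = here
embed⊆ (inside ∷ X) {suc m} e (_ ∷ Z) (there j∈) = there (embed⊆ X (suc-injective e) Z j∈)
embed⊆ (outside ∷ X) e Z (there j∈) = there (embed⊆ X e Z j∈)

∣embed∣≡∣Z∣ : ∀ {n} (X : Subset n) {m} (e : ∣ X ∣ ≡ m) (Z : Subset m) → ∣ embed X e Z ∣ ≡ ∣ Z ∣
∣embed∣≡∣Z∣ [] {zero} e [] = refl
∣embed∣≡∣Z∣ (inside ∷ X) {zero} () Z
∣embed∣≡∣Z∣ (inside ∷ X) {suc m} e (inside ∷ Z) = cong suc (∣embed∣≡∣Z∣ X (suc-injective e) Z)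
∣embed∣≡∣Z∣ (inside ∷ X) {suc m} e (outside ∷ Z) = ∣embed∣≡∣Z∣ X (suc-injective e) Z
∣embed∣≡∣Z∣ (outside ∷ X) e Z = ∣embed∣≡∣Z∣ X e Z

embed-injective : ∀ {n} (X : Subset n) {m} (e : ∣ X ∣ ≡ m) → Injective _≡_ _≡_ (embed X e)
embed-injective [] {zero} e {[]} {[]} _ = refl
embed-injective (inside ∷ X) {zero} ()
embed-injective (inside ∷ X) {suc m} e {_ ∷ Z₁} {_ ∷ Z₂} eq =
  cong₂ _∷_ (Vec.∷-injectiveˡ eq) (embed-injective X (suc-injective e) (Vec.∷-injectiveʳ eq))
embed-injective (outside ∷ X) e eq = embed-injective X e (Vec.∷-injectiveʳ eq)

embed-restrict : ∀ {n} (X : Subset n) {m} (e : ∣ X ∣ ≡ m) {Y : Subset n} → Y ⊆ X → embed X e (restrict X e Y) ≡ Y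
embed-restrict [] {zero} e {[]} _ = refl
embed-restrict (inside ∷ X) {zero} ()
embed-restrict (inside ∷ X) {suc m} e {y ∷ Y} Y⊆X = cong (y ∷_) (embed-restrict X (suc-injective e) (drop-∷-⊆ Y⊆X))
embed-restrict (outside ∷ X) e {inside ∷ Y} Y⊆X with () ← Y⊆X here
embed-restrict (outside ∷ X) e {outside ∷ Y} Y⊆X = cong (outside ∷_) (embed-restrict X e (drop-∷-⊆ Y⊆X))

-- Binomial coefficients and the standard family

nCk*[k!*[n∸k]!]≡n! : ∀ {n k} → k ≤ n → (n C k) * (k ! * (n ∸ k) !) ≡ n !
nCk*[k!*[n∸k]!]≡n! {n} {k} k≤n = begin
  (n C k) * (k ! * (n ∸ k) !)
    ≡⟨ cong (_* (k ! * (n ∸ k) !)) (nCk≡n!/k![n-k]! k≤n) ⟩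
  (n ! / (k ! * (n ∸ k) !)) {{k !* (n ∸ k) !≢0}} * (k ! * (n ∸ k) !)
    ≡⟨ m/n*n≡m {{k !* (n ∸ k) !≢0}} (k![n∸k]!∣n! k≤n) ⟩
  n ! ∎
  where open ≡-Reasoning

2k∸k≡k : ∀ k → 2 * k ∸ k ≡ k
2k∸k≡k k = trans (m+n∸m≡n k (k + 0)) (+-identityʳ k)

2kCk*[k!*k!]≡[2k]! : ∀ k → ((2 * k) C k) * (k ! * k !) ≡ (2 * k) !
2kCk*[k!*k!]≡[2k]! k =
  subst (λ j → ((2 * k) C k) * (k ! * j !) ≡ (2 * k) !) (2k∸k≡k k) (nCk*[k!*[n∸k]!]≡n! (m≤m+n k (k + 0)))

2kCk≢0 : ∀ k → NonZero ((2 * k) C k)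
2kCk≢0 k = m*n≢0⇒m≢0 ((2 * k) C k) {{subst NonZero (sym (2kCk*[k!*k!]≡[2k]! k)) ((2 * k) !≢0)}}

count-≟-allSubsets : ∀ {m} (Z : Subset m) → count (_≟ₛ Z) (allSubsets m) ≡ 1
count-≟-allSubsets [] = refl
count-≟-allSubsets {suc m} (z ∷ Z) = begin
  count (_≟ₛ (z ∷ Z)) (map (inside ∷_) (allSubsets m) ++ map (outside ∷_) (allSubsets m))
    ≡⟨ count-++ (_≟ₛ (z ∷ Z)) (map (inside ∷_) (allSubsets m)) _ ⟩
  count (_≟ₛ (z ∷ Z)) (map (inside ∷_) (allSubsets m)) + count (_≟ₛ (z ∷ Z)) (map (outside ∷_) (allSubsets m))
    ≡⟨ cong₂ _+_ (count-map (_≟ₛ (z ∷ Z)) (inside ∷_) (allSubsets m))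
                 (count-map (_≟ₛ (z ∷ Z)) (outside ∷_) (allSubsets m)) ⟩
  count (λ W → (inside ∷ W) ≟ₛ (z ∷ Z)) (allSubsets m) + count (λ W → (outside ∷ W) ≟ₛ (z ∷ Z)) (allSubsets m)
    ≡⟨ split z ⟩
  1 ∎
  where
  open ≡-Reasoning
  same-head : ∀ x → count (λ W → (x ∷ W) ≟ₛ (x ∷ Z)) (allSubsets m) ≡ 1
  same-head x = trans (count-cong _ (_≟ₛ Z) (allSubsets m) (λ _ → Vec.∷-injectiveʳ) (λ _ → cong (x ∷_)))
                      (count-≟-allSubsets Z)
  other-head : ∀ {x y} → x ≢ y → count (λ W → (x ∷ W) ≟ₛ (y ∷ Z)) (allSubsets m) ≡ 0
  other-head x≢y = count-none _ (allSubsets m) (λ _ → x≢y ∘ Vec.∷-injectiveˡ)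
  split : ∀ z → count (λ W → (inside ∷ W) ≟ₛ (z ∷ Z)) (allSubsets m)
                + count (λ W → (outside ∷ W) ≟ₛ (z ∷ Z)) (allSubsets m) ≡ 1
  split inside = cong₂ _+_ (same-head inside) (other-head λ ())
  split outside = cong₂ _+_ (other-head λ ()) (same-head outside)

count-allSubsets-unique : ∀ {m} {R : Subset m → Set} (R? : Decidable R) {Z} → R Z → (∀ {W} → R W → W ≡ Z) →
                          count R? (allSubsets m) ≡ 1
count-allSubsets-unique {m} R? {Z} RZ unique =
  trans (count-cong R? (_≟ₛ Z) (allSubsets m) (λ _ → unique) (λ { _ refl → RZ })) (count-≟-allSubsets Z)

length-kSubsets : ∀ m k → length (kSubsets m k) ≡ m C k
length-kSubsets zero zero = refl
length-kSubsets zero (suc k) = refl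
length-kSubsets (suc m) k = begin
  count (λ A → ∣ A ∣ ≟ k) (map (inside ∷_) (allSubsets m) ++ map (outside ∷_) (allSubsets m))
    ≡⟨ count-++ (λ A → ∣ A ∣ ≟ k) (map (inside ∷_) (allSubsets m)) _ ⟩
  count (λ A → ∣ A ∣ ≟ k) (map (inside ∷_) (allSubsets m)) + count (λ A → ∣ A ∣ ≟ k) (map (outside ∷_) (allSubsets m))
    ≡⟨ cong₂ _+_ (count-map (λ A → ∣ A ∣ ≟ k) (inside ∷_) (allSubsets m))
                 (count-map (λ A → ∣ A ∣ ≟ k) (outside ∷_) (allSubsets m)) ⟩
  count (λ A → suc ∣ A ∣ ≟ k) (allSubsets m) + length (kSubsets m k)
    ≡⟨ Pascal k ⟩
  suc m C k ∎
  where
  open ≡-Reasoning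
  Pascal : ∀ k → count (λ A → suc ∣ A ∣ ≟ k) (allSubsets m) + length (kSubsets m k) ≡ suc m C k
  Pascal zero = trans (cong (_+ length (kSubsets m 0)) (count-none _ (allSubsets m) λ _ ())) (length-kSubsets m 0)
  Pascal (suc j) = begin
    count (λ A → suc ∣ A ∣ ≟ suc j) (allSubsets m) + length (kSubsets m (suc j))
      ≡⟨ cong₂ _+_ (count-cong _ (λ A → ∣ A ∣ ≟ j) (allSubsets m) (λ _ → suc-injective) (λ _ → cong suc))
                   (length-kSubsets m (suc j)) ⟩
    length (kSubsets m j) + m C suc j  ≡⟨ cong (_+ m C suc j) (length-kSubsets m j) ⟩
    m C j + m C suc j                   ≡⟨ nCk+nC[k+1]≡[n+1]C[k+1] m j ⟩
    suc m C suc j                       ∎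

count-kSubsets-unique : ∀ {m k} {R : Subset m → Set} (R? : Decidable R) {Z} → ∣ Z ∣ ≡ k → R Z →
                        (∀ {W} → ∣ W ∣ ≡ k → R W → W ≡ Z) → count R? (kSubsets m k) ≡ 1
count-kSubsets-unique {m} {k} R? ∣Z∣≡k RZ unique =
  trans (count-filter R? (λ A → ∣ A ∣ ≟ k) (allSubsets m))
        (count-allSubsets-unique (λ A → R? A ×-dec ∣ A ∣ ≟ k) (RZ , ∣Z∣≡k) λ (RW , ∣W∣≡k) → unique ∣W∣≡k RW)

module _ (k s : ℕ) where

  standard-uniform : Uniform k (standard k s)
  standard-uniform =
    AllP.concat⁺ (AllP.map⁺ (All.map (AllP.replicate⁺ s) (AllP.all-filter (λ A → ∣ A ∣ ≟ k) (allSubsets (2 * k)))))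

  length-standard : length (standard k s) ≡ s * ((2 * k) C k)
  length-standard = trans (length-concatMap-replicate (kSubsets (2 * k) k)) (cong (s *_) (length-kSubsets (2 * k) k))
    where
    length-concatMap-replicate : (xs : List (Subset (2 * k))) → length (concatMap (replicate s) xs) ≡ s * length xs
    length-concatMap-replicate [] = sym (*-zeroʳ s)
    length-concatMap-replicate (x ∷ xs) = begin
      length (replicate s x ++ concatMap (replicate s) xs)  ≡⟨ length-++ (replicate s x) ⟩
      length (replicate s x) + length (concatMap (replicate s) xs)
        ≡⟨ cong₂ _+_ (length-replicate s) (length-concatMap-replicate xs) ⟩
      s + s * length xs                                     ≡⟨ *-suc s (length xs) ⟨
      s * suc (length xs)                                   ∎
      where open ≡-Reasoning

  count-≟-standard : ∀ {Z} → ∣ Z ∣ ≡ k → count (_≟ₛ Z) (standard k s) ≡ s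
  count-≟-standard {Z} ∣Z∣≡k =
    trans (count-concatMap-replicate (_≟ₛ Z) s (kSubsets (2 * k) k))
          (trans (cong (s *_) (count-kSubsets-unique (_≟ₛ Z) ∣Z∣≡k refl (λ _ W≡Z → W≡Z))) (*-identityʳ s))

  standard-almostIntersecting : SAlmostIntersecting s (standard k s)
  standard-almostIntersecting = All.tabulate λ A∈ → let eq = disjointCount≡s (All.lookup standard-uniform A∈)
                                                     in ≤-reflexive (sym eq) , ≤-reflexive eq
    where
    ∣∁A∣≡k : ∀ {A : Subset (2 * k)} → ∣ A ∣ ≡ k → ∣ ∁ A ∣ ≡ k
    ∣∁A∣≡k {A} ∣A∣≡k = trans (∣∁p∣≡n∸∣p∣ A) (trans (cong (2 * k ∸_) ∣A∣≡k) (2k∸k≡k k))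
    disjointCount≡s : ∀ {A} → ∣ A ∣ ≡ k → disjointCount A (standard k s) ≡ s
    disjointCount≡s {A} ∣A∣≡k =
      trans (count-concatMap-replicate (disjoint? A) s (kSubsets (2 * k) k))
            (trans (cong (s *_) (count-kSubsets-unique (disjoint? A) (∣∁A∣≡k {A} ∣A∣≡k)
                                                          (∉⇒Disjoint x∈p⇒x∉∁p) unique))
                   (*-identityʳ s))
      where
      unique : ∀ {W} → ∣ W ∣ ≡ k → Disjoint A W → W ≡ ∁ A
      unique ∣W∣≡k A∩W≡∅ = p⊆q∧∣p∣≡∣q∣⇒p≡q (λ x∈W → x∉p⇒x∈∁p λ x∈A → Disjoint⇒∉ A∩W≡∅ x∈A x∈W)
                                           (trans ∣W∣≡k (sym (∣∁A∣≡k {A} ∣A∣≡k)))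

-- Almost intersecting families

module _ {n k s : ℕ} {F : MultiHypergraph n} (k≢0 : k ≢ 0)
         (uniform : Uniform k F) (almost : AlmostIntersecting 1 s F) where

  private
    variable
      A B E : Subset n

  open import Data.List.Membership.DecPropositional (_≟ₛ_ {n}) using () renaming (_∈?_ to _∈ₗ?_)

  ∣edge∣≡k : A ∈ₗ F → ∣ A ∣ ≡ k
  ∣edge∣≡k = All.lookup uniform

  edge-nonempty : A ∈ₗ F → Nonempty A
  edge-nonempty A∈F = ∣p∣≢0⇒Nonempty (k≢0 ∘ trans (sym (∣edge∣≡k A∈F)))

  ⊆-k-sets⇒≡ : ∣ A ∣ ≡ k → ∣ B ∣ ≡ k → A ⊆ B → A ≡ B
  ⊆-k-sets⇒≡ ∣A∣≡k ∣B∣≡k A⊆B = p⊆q∧∣p∣≡∣q∣⇒p≡q A⊆B (trans ∣A∣≡k (sym ∣B∣≡k))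

  disjointCount≤s : A ∈ₗ F → disjointCount A F ≤ s
  disjointCount≤s A∈F = proj₂ (All.lookup almost A∈F)

  PartnerChoice : (Subset n → Subset n) → Set
  PartnerChoice p = ∀ {A} → A ∈ₗ F → p A ∈ₗ F × Disjoint A (p A)

  -- The fallback A is junk: edges of F always have a disjoint edge.
  partner : Subset n → Subset n
  partner A with any? (disjoint? A) F
  ... | yes some = proj₁ (find some)
  ... | no _ = A

  partner-choice : PartnerChoice partner
  partner-choice {A} A∈F with any? (disjoint? A) F
  ... | yes some = proj₂ (find some)
  ... | no none with count-≢0⇒∃∈ (disjoint? A) F (λ eq → <⇒≱ (proj₁ (All.lookup almost A∈F)) (≤-reflexive eq))
  ...   | B , B∈F , A∩B≡∅ = ⊥-elim (none (lose B∈F A∩B≡∅))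

  preferring : Subset n → Subset n → Subset n
  preferring B A with disjoint? A B
  ... | yes _ = B
  ... | no _ = partner A

  preferring-choice : B ∈ₗ F → PartnerChoice (preferring B)
  preferring-choice {B} B∈F {A} A∈F with disjoint? A B
  ... | yes A∩B≡∅ = B∈F , A∩B≡∅
  ... | no _ = partner-choice A∈F

  preferring-≡ : Disjoint A B → preferring B A ≡ B
  preferring-≡ {A} {B} A∩B≡∅ with disjoint? A B
  ... | yes _ = refl
  ... | no ¬A∩B≡∅ = ⊥-elim (¬A∩B≡∅ A∩B≡∅)

  early : (Subset n → Subset n) → Ordering n → ℕ
  early p π = count (λ A → precedes? A (p A) π) F

  entry : Ordering n → Subset n → ℕ
  entry π E = minOn (position π) E

  Last : Ordering n → Subset n → Set
  Last π B = B ∈ₗ F × ∀ {E} → E ∈ₗ F → entry π E ≤ entry π B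

  last-exists : ∀ π → A ∈ₗ F → ∃[ B ] Last π B
  last-exists {A} π A∈F = argmax (entry π) A F , argmax∈F , All.lookup (f[xs]≤f[argmax] A F)
    where
    argmax∈F : argmax (entry π) A F ∈ₗ F
    argmax∈F with argmax-sel (entry π) A F
    ... | inj₁ argmax≡A = subst (_∈ₗ F) (sym argmax≡A) A∈F
    ... | inj₂ argmax∈F = argmax∈F

  -- An early edge enters strictly before its partner, hence before any last edge.
  early⇒Disjoint : ∀ {p π} → PartnerChoice p → Last π B → E ∈ₗ F → Precedes E (p E) π → Disjoint B E
  early⇒Disjoint {B} {E} {p} {π} choice (B∈F , latest) E∈F E≺pE (y , y∈B∩E)
    with x , x∈pE , px≡entry ← minOn-attained (position π) (edge-nonempty (proj₁ (choice E∈F)))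
    with y∈B , y∈E ← x∈p∩q⁻ B E y∈B∩E =
    <⇒≱ (E≺pE y∈E x∈pE) (begin
      position π x     ≡⟨ px≡entry ⟩
      entry π (p E)    ≤⟨ latest (proj₁ (choice E∈F)) ⟩
      entry π B        ≤⟨ minOn-≤ (position π) y∈B ⟩
      position π y     ∎)
    where open ≤-Reasoning

  early≤s : ∀ {p} → PartnerChoice p → ∀ π → early p π ≤ s
  early≤s {p} choice π with early p π ≟ 0
  ... | yes early≡0 = subst (_≤ s) (sym early≡0) z≤n
  ... | no early≢0 with A , A∈F , _ ← count-≢0⇒∃∈ _ F early≢0 with B , last ← last-exists π A∈F =
    ≤-trans (count-mono _ (disjoint? B) F (early⇒Disjoint {π = π} choice last)) (disjointCount≤s (proj₁ last))

  allOrderings : List (Ordering n)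
  allOrderings = orderings n ⊤

  -- (2k)! times the number of orderings placing a given k-set before a disjoint k-set.
  weight : ℕ
  weight = n ! * (k ! * k !)

  private
    instance
      weight≢0 : NonZero weight
      weight≢0 = m*n≢0 (n !) (k ! * k !) {{n !≢0}} {{k !* k !≢0}}

  count-precedes-partner : ∀ {p} → PartnerChoice p → A ∈ₗ F →
                           (2 * k) ! * count (precedes? A (p A)) allOrderings ≡ weight
  count-precedes-partner {A} {p} choice A∈F = begin
    (2 * k) ! * count (precedes? A (p A)) allOrderings
      ≡⟨ cong (λ j → j ! * count (precedes? A (p A)) allOrderings) 2k≡∣A∣+∣pA∣ ⟩
    (∣ A ∣ + ∣ p A ∣) ! * count (precedes? A (p A)) allOrderings
      ≡⟨ count-precedes n ⊤ A (p A) (∣⊤∣≡n n) (λ _ → ∈⊤) (λ _ → ∈⊤) (proj₂ (choice A∈F)) ⟩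
    n ! * (∣ A ∣ ! * ∣ p A ∣ !)
      ≡⟨ cong₂ (λ a b → n ! * (a ! * b !)) (∣edge∣≡k A∈F) (∣edge∣≡k (proj₁ (choice A∈F))) ⟩
    weight ∎
    where
    open ≡-Reasoning
    2k≡∣A∣+∣pA∣ : 2 * k ≡ ∣ A ∣ + ∣ p A ∣
    2k≡∣A∣+∣pA∣ = sym (cong₂ _+_ (∣edge∣≡k A∈F) (trans (∣edge∣≡k (proj₁ (choice A∈F))) (sym (+-identityʳ k))))

  ∑early : ∀ {p} → PartnerChoice p → (2 * k) ! * sum (map (early p) allOrderings) ≡ length F * weight
  ∑early {p} choice =
    trans (cong ((2 * k) ! *_) (sum-count-swap (λ π A → precedes? A (p A) π) allOrderings F))
          (*-sum-map-const ((2 * k) !) weight _ F (count-precedes-partner choice))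

  ∑early≤ : ∀ {p} → PartnerChoice p → sum (map (early p) allOrderings) ≤ n ! * s
  ∑early≤ {p} choice =
    subst (λ N → sum (map (early p) allOrderings) ≤ N * s) (length-orderings n ⊤ (∣⊤∣≡n n))
          (sum-map-≤ s (early p) allOrderings (early≤s choice))

  private
    rearrange : ∀ c f N s → (c * f) * (N * s) ≡ (s * c) * (N * f)
    rearrange = solve-∀

  bound : length F ≤ s * ((2 * k) C k)
  bound = *-cancelʳ-≤ (length F) (s * ((2 * k) C k)) weight (begin
    length F * weight                          ≡⟨ ∑early partner-choice ⟨
    (2 * k) ! * sum (map (early partner) allOrderings)  ≤⟨ *-monoʳ-≤ ((2 * k) !) (∑early≤ partner-choice) ⟩
    (2 * k) ! * (n ! * s)                      ≡⟨ cong (_* (n ! * s)) (2kCk*[k!*k!]≡[2k]! k) ⟨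
    (((2 * k) C k) * (k ! * k !)) * (n ! * s)  ≡⟨ rearrange ((2 * k) C k) (k ! * k !) (n !) s ⟩
    (s * ((2 * k) C k)) * weight              ∎)
    where open ≤-Reasoning

  entry-≤ : ∀ {π} → Nonempty B → ∃[ e ] e ∈ E × (∀ {b} → b ∈ B → position π e ≤ position π b) →
            entry π E ≤ entry π B
  entry-≤ {π = π} = minOn-≤-minOn (position π)

  Last-of-top : ∀ {π D} → D ∈ₗ F → (∀ {e c} → e ∉ D → c ∈ D → position π e ≤ position π c) → Last π D
  Last-of-top {π} {D} D∈F below = D∈F , latest
    where
    latest : ∀ {E} → E ∈ₗ F → entry π E ≤ entry π D
    latest {E} E∈F with ⊆-or-∃∉ E D
    ... | inj₁ E⊆D = ≤-reflexive (cong (entry π) (⊆-k-sets⇒≡ (∣edge∣≡k E∈F) (∣edge∣≡k D∈F) E⊆D))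
    ... | inj₂ (e , e∈E , e∉D) = entry-≤ {π = π} (edge-nonempty D∈F) (e , e∈E , below e∉D)

  ranked : (r : Fin n → ℕ) → ∃[ π ] π ∈ₗ allOrderings × (∀ {y z} → r y < r z → position π y < position π z)
  ranked r with π , π∈ , respects ← orderings-refine r n ⊤ (∣⊤∣≡n n) = π , π∈ , respects ∈⊤ ∈⊤

  module _ (tight : length F ≡ s * ((2 * k) C k)) where

    early≡s : ∀ {p} → PartnerChoice p → ∀ {π} → π ∈ₗ allOrderings → early p π ≡ s
    early≡s {p} choice = sum-map-≤-tight s (early p) allOrderings (early≤s choice)
      (trans ∑early≡ (cong (_* s) (sym (length-orderings n ⊤ (∣⊤∣≡n n)))))
      where
      ∑early≡ : sum (map (early p) allOrderings) ≡ n ! * s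
      ∑early≡ = *-cancelˡ-≡ _ _ ((2 * k) !) {{(2 * k) !≢0}} (begin
        (2 * k) ! * sum (map (early p) allOrderings)  ≡⟨ ∑early choice ⟩
        length F * weight                           ≡⟨ cong (_* weight) tight ⟩
        (s * ((2 * k) C k)) * weight                ≡⟨ rearrange ((2 * k) C k) (k ! * k !) (n !) s ⟨
        (((2 * k) C k) * (k ! * k !)) * (n ! * s)   ≡⟨ cong (_* (n ! * s)) (2kCk*[k!*k!]≡[2k]! k) ⟩
        (2 * k) ! * (n ! * s)                       ∎)
        where open ≡-Reasoning

    -- Tightness makes the inclusion used in early≤s an equality: the early edges are exactly those disjoint from B.
    Last⇒early : ∀ {p π} → PartnerChoice p → π ∈ₗ allOrderings → Last π B →
                 E ∈ₗ F → Disjoint B E → Precedes E (p E) π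
    Last⇒early {B} {p = p} {π} choice π∈ last =
      count-mono-tight _ (disjoint? B) F (early⇒Disjoint {π = π} choice last)
        (≤-trans (disjointCount≤s (proj₁ last)) (≤-reflexive (sym (early≡s choice π∈))))

    -- In an ordering ending with the vertices of D, the s early edges are all disjoint from D.
    disjointCount≡s : ∀ {D} → D ∈ₗ F → disjointCount D F ≡ s
    disjointCount≡s {D} D∈F with π , π∈ , respects ← ranked (λ y → indicator (y ∈? D)) =
      ≤-antisym (disjointCount≤s D∈F) (begin
        s                          ≡⟨ early≡s partner-choice π∈ ⟨
        early partner π            ≤⟨ count-mono _ (disjoint? D) F (early⇒Disjoint {π = π} partner-choice last) ⟩
        disjointCount D F          ∎)
      where
      open ≤-Reasoning
      last : Last π D
      last = Last-of-top {π = π} D∈F λ {e} {c} e∉D c∈D → <⇒≤ (respects {e} {c}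
        (subst₂ _<_ (sym (indicator-no (e ∈? D) e∉D)) (sym (indicator-yes (c ∈? D) c∈D)) (s≤s z≤n)))

    private
      layered-rank : Subset n → Fin n → Fin n → ℕ
      layered-rank D a y = 2 * indicator (y ∈? D) + indicator (y Fin.≟ a)

    -- Rank D highest and a ∈ A next: D enters last, so A precedes its partner B, yet b ∈ B ∖ D comes before a.
    Disjoint-unique : ∀ {D A} → D ∈ₗ F → A ∈ₗ F → Disjoint D A → B ∈ₗ F → Disjoint A B → B ≡ D
    Disjoint-unique {B} {D} {A} D∈F A∈F D∩A≡∅ B∈F A∩B≡∅ with ⊆-or-∃∉ B D
    ... | inj₁ B⊆D = ⊆-k-sets⇒≡ (∣edge∣≡k B∈F) (∣edge∣≡k D∈F) B⊆D
    ... | inj₂ (b , b∈B , b∉D) with a , a∈A ← edge-nonempty A∈F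
      with π , π∈ , respects ← ranked (layered-rank D a) =
      ⊥-elim (<-asym (respects rb<ra) (A≺B a∈A b∈B))
      where
      a∉D : a ∉ D
      a∉D = Disjoint⇒∉ (Disjoint-sym D∩A≡∅) a∈A
      b≢a : b ≢ a
      b≢a refl = Disjoint⇒∉ A∩B≡∅ a∈A b∈B
      rb<ra : layered-rank D a b < layered-rank D a a
      rb<ra rewrite indicator-no (b ∈? D) b∉D | indicator-no (b Fin.≟ a) b≢a
                  | indicator-no (a ∈? D) a∉D | indicator-yes (a Fin.≟ a) refl = s≤s z≤n
      last : Last π D
      last = Last-of-top {π = π} D∈F λ {e} {c} e∉D c∈D → <⇒≤ (respects {e} {c} (below e∉D c∈D))
        where
        below : ∀ {e c} → e ∉ D → c ∈ D → layered-rank D a e < layered-rank D a c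
        below {e} {c} e∉D c∈D rewrite indicator-no (e ∈? D) e∉D | indicator-yes (c ∈? D) c∈D =
          s≤s (≤-trans (indicator≤1 (e Fin.≟ a)) (s≤s z≤n))
      A≺B : Precedes A B π
      A≺B = subst (λ B′ → Precedes A B′ π) (preferring-≡ A∩B≡∅)
                  (Last⇒early (preferring-choice B∈F) π∈ last A∈F D∩A≡∅)

    private
      exchange-rank : Subset n → Fin n → Fin n → Fin n → ℕ
      exchange-rank A a d y = indicator (y ∈? A) + 2 * indicator (y ∈? replace A a d)

    -- Rank the vertices outside A ∪ ⁅ d ⁆ lowest, then a, then d, then A - a. If replace A a d ∉ F then A
    -- enters last, so D precedes its partner A, although a comes before d.
    replace-∈ : ∀ {A D a d} → A ∈ₗ F → D ∈ₗ F → Disjoint A D → a ∈ A → d ∈ D → replace A a d ∈ₗ F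
    replace-∈ {A} {D} {a} {d} A∈F D∈F A∩D≡∅ a∈A d∈D with replace A a d ∈ₗ? F
    ... | yes A′∈F = A′∈F
    ... | no A′∉F with π , π∈ , respects ← ranked (exchange-rank A a d) = ⊥-elim (<-asym (respects ra<rd) (D≺A d∈D a∈A))
      where
      A′ : Subset n
      A′ = replace A a d
      rank : Fin n → ℕ
      rank = exchange-rank A a d
      d∉A : d ∉ A
      d∉A d∈A = Disjoint⇒∉ A∩D≡∅ d∈A d∈D
      a∉A′ : a ∉ A′
      a∉A′ a∈A′ with ∈-replace⁻ a∈A′
      ... | inj₁ (_ , a≢a) = a≢a refl
      ... | inj₂ refl = d∉A a∈A
      ra<rd : rank a < rank d
      ra<rd rewrite indicator-yes (a ∈? A) a∈A | indicator-no (a ∈? A′) a∉A′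
                  | indicator-no (d ∈? A) d∉A | indicator-yes (d ∈? A′) ∈-replace⁺ʳ = s≤s (s≤s z≤n)
      ra≤rc : ∀ {c} → c ∈ A → position π a ≤ position π c
      ra≤rc {c} c∈A with a Fin.≟ c
      ... | yes refl = ≤-refl
      ... | no a≢c = <⇒≤ (respects {a} {c} ra<rc)
        where
        ra<rc : rank a < rank c
        ra<rc rewrite indicator-yes (a ∈? A) a∈A | indicator-no (a ∈? A′) a∉A′
                    | indicator-yes (c ∈? A) c∈A | indicator-yes (c ∈? A′) (∈-replace⁺ˡ c∈A (a≢c ∘ sym))
                    = s≤s (s≤s z≤n)
      re<rc : ∀ {e c} → e ∉ A → e ∉ A′ → c ∈ A → rank e < rank c
      re<rc {e} {c} e∉A e∉A′ c∈A rewrite indicator-no (e ∈? A) e∉A | indicator-no (e ∈? A′) e∉A′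
                                        | indicator-yes (c ∈? A) c∈A = s≤s z≤n
      latest : ∀ {E} → E ∈ₗ F → entry π E ≤ entry π A
      latest {E} E∈F with a ∈? E
      ... | yes a∈E = entry-≤ {π = π} (a , a∈A) (a , a∈E , ra≤rc)
      ... | no a∉E with ⊆-or-∃∉ E A′
      ...   | inj₁ E⊆A′ = ⊥-elim (A′∉F (subst (_∈ₗ F) E≡A′ E∈F))
        where
        E≡A′ : E ≡ A′
        E≡A′ = ⊆-k-sets⇒≡ (∣edge∣≡k E∈F) (trans (∣replace∣≡∣p∣ a∈A d∉A) (∣edge∣≡k A∈F)) E⊆A′
      ...   | inj₂ (e , e∈E , e∉A′) =
        entry-≤ {π = π} (a , a∈A) (e , e∈E , λ c∈A → <⇒≤ (respects (re<rc e∉A e∉A′ c∈A)))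
        where
        e∉A : e ∉ A
        e∉A e∈A = e∉A′ (∈-replace⁺ˡ e∈A λ { refl → a∉E e∈E })
      D≺A : Precedes D A π
      D≺A = subst (λ A″ → Precedes D A″ π) (preferring-≡ (Disjoint-sym A∩D≡∅))
                  (Last⇒early (preferring-choice A∈F) π∈ (A∈F , latest) D∈F A∩D≡∅)

    module _ {A₀ : Subset n} (A₀∈F : A₀ ∈ₗ F) where

      X : Subset n
      X = A₀ ∪ partner A₀

      ∣X∣≡2k : ∣ X ∣ ≡ 2 * k
      ∣X∣≡2k = trans (Disjoint⇒∣p∪q∣≡∣p∣+∣q∣ (proj₂ (partner-choice A₀∈F)))
                     (cong₂ _+_ (∣edge∣≡k A₀∈F) (trans (∣edge∣≡k (proj₁ (partner-choice A₀∈F))) (sym (+-identityʳ k))))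

      Complemented : Subset n → Set
      Complemented A = A ∈ₗ F × A ⊆ X × X ─ A ∈ₗ F

      complemented-A₀ : Complemented A₀
      complemented-A₀ = A₀∈F , p⊆p∪q _ , subst (_∈ₗ F) (sym X─A₀≡partner) (proj₁ (partner-choice A₀∈F))
        where
        X─A₀≡partner : X ─ A₀ ≡ partner A₀
        X─A₀≡partner = ⊆-antisym
          (λ y∈X─A₀ → case x∈p∪q⁻ A₀ _ (p─q⊆p _ _ y∈X─A₀) of λ where
             (inj₁ y∈A₀) → ⊥-elim (x∈p─q⇒x∉q y∈X─A₀ y∈A₀)
             (inj₂ y∈partner) → y∈partner)
          (λ y∈partner → x∈p∧x∉q⇒x∈p─q (q⊆p∪q A₀ _ y∈partner)
                                       (λ y∈A₀ → Disjoint⇒∉ (proj₂ (partner-choice A₀∈F)) y∈A₀ y∈partner))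

      complemented-replace : ∀ {A a d} → Complemented A → a ∈ A → d ∈ X ─ A → Complemented (replace A a d)
      complemented-replace {A} {a} {d} (A∈F , A⊆X , X─A∈F) a∈A d∈X─A =
        replace-∈ A∈F X─A∈F (Disjoint-─ A X) a∈A d∈X─A ,
        A′⊆X ,
        subst (_∈ₗ F) (sym (─-replace a∈A A⊆X d∈X─A))
              (replace-∈ X─A∈F A∈F (Disjoint-sym (Disjoint-─ A X)) d∈X─A a∈A)
        where
        A′⊆X : replace A a d ⊆ X
        A′⊆X y∈A′ with ∈-replace⁻ y∈A′
        ... | inj₁ (y∈A , _) = A⊆X y∈A
        ... | inj₂ refl = p─q⊆p _ _ d∈X─A

      -- Every k-subset Y of X is reached from A₀ by exchanges, each moving one vertex into Y.
      complemented : ∀ {Y} → Y ⊆ X → ∣ Y ∣ ≡ k → Complemented Y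
      complemented {Y} Y⊆X ∣Y∣≡k = reach (suc ∣ A₀ ─ Y ∣) A₀ ≤-refl complemented-A₀
        where
        reach : ∀ bound A → ∣ A ─ Y ∣ < bound → Complemented A → Complemented Y
        reach (suc bound) A ∣A─Y∣<bound A-compl@(A∈F , A⊆X , _) with ⊆-or-∃∉ A Y | ⊆-or-∃∉ Y A
        ... | inj₁ A⊆Y | _ = subst Complemented (⊆-k-sets⇒≡ (∣edge∣≡k A∈F) ∣Y∣≡k A⊆Y) A-compl
        ... | inj₂ (a , a∈A , a∉Y) | inj₁ Y⊆A =
          ⊥-elim (a∉Y (subst (a ∈_) (sym (⊆-k-sets⇒≡ ∣Y∣≡k (∣edge∣≡k A∈F) Y⊆A)) a∈A))
        ... | inj₂ (a , a∈A , a∉Y) | inj₂ (d , d∈Y , d∉A) =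
          reach bound (replace A a d) (≤-trans (p⊂q⇒∣p∣<∣q∣ shrinks) (≤-pred ∣A─Y∣<bound))
                (complemented-replace A-compl a∈A (x∈p∧x∉q⇒x∈p─q (Y⊆X d∈Y) d∉A))
          where
          shrinks : replace A a d ─ Y ⊂ A ─ Y
          shrinks = (λ y∈ → case ∈-replace⁻ (p─q⊆p _ _ y∈) of λ where
                       (inj₁ (y∈A , _)) → x∈p∧x∉q⇒x∈p─q y∈A (x∈p─q⇒x∉q y∈)
                       (inj₂ refl) → ⊥-elim (x∈p─q⇒x∉q y∈ d∈Y))
                  , a , x∈p∧x∉q⇒x∈p─q a∈A a∉Y
                  , λ a∈A′─Y → case ∈-replace⁻ (p─q⊆p _ _ a∈A′─Y) of λ where
                       (inj₁ (_ , a≢a)) → a≢a refl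
                       (inj₂ refl) → d∉A a∈A

      count-≟-⊆X≡s : ∀ {Y} → Y ⊆ X → ∣ Y ∣ ≡ k → count (_≟ₛ Y) F ≡ s
      count-≟-⊆X≡s {Y} Y⊆X ∣Y∣≡k with Y∈F , _ , X─Y∈F ← complemented Y⊆X ∣Y∣≡k =
        trans (count-cong (_≟ₛ Y) (disjoint? (X ─ Y)) F
                 (λ _ E≡Y → subst (Disjoint (X ─ Y)) (sym E≡Y) (Disjoint-sym (Disjoint-─ Y X)))
                 (λ E∈F X─Y∩E≡∅ → Disjoint-unique Y∈F X─Y∈F (Disjoint-─ Y X) E∈F X─Y∩E≡∅))
              (disjointCount≡s X─Y∈F)

      private
        e : ∣ X ∣ ≡ 2 * k
        e = ∣X∣≡2k

      count-embed-standard-inside : ∀ {Y} → Y ⊆ X → ∣ Y ∣ ≡ k → count (_≟ₛ Y) (map (embed X e) (standard k s)) ≡ s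
      count-embed-standard-inside {Y} Y⊆X ∣Y∣≡k =
        trans (count-map (_≟ₛ Y) (embed X e) (standard k s))
              (trans (count-cong _ (_≟ₛ restrict X e Y) (standard k s)
                        (λ _ embedZ≡Y → embed-injective X e (trans embedZ≡Y (sym (embed-restrict X e Y⊆X))))
                        (λ { _ refl → embed-restrict X e Y⊆X }))
                     (count-≟-standard k s ∣restrict∣≡k))
        where
        ∣restrict∣≡k : ∣ restrict X e Y ∣ ≡ k
        ∣restrict∣≡k = trans (sym (∣embed∣≡∣Z∣ X e _)) (trans (cong ∣_∣ (embed-restrict X e Y⊆X)) ∣Y∣≡k)

      count-embed-standard-outside : ∀ {Y} → ¬ (Y ⊆ X × ∣ Y ∣ ≡ k) →
                                     count (_≟ₛ Y) (map (embed X e) (standard k s)) ≡ 0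
      count-embed-standard-outside {Y} ¬inside =
        trans (count-map (_≟ₛ Y) (embed X e) (standard k s))
              (count-none _ (standard k s) λ {Z} Z∈ → λ { refl →
                 ¬inside (embed⊆ X e Z , trans (∣embed∣≡∣Z∣ X e Z) (All.lookup (standard-uniform k s) Z∈)) })

      count-filter-inside : ∀ {Y} → Y ⊆ X → ∣ Y ∣ ≡ k → count (_≟ₛ Y) (filter (_⊆? X) F) ≡ s
      count-filter-inside {Y} Y⊆X ∣Y∣≡k =
        trans (count-filter (_≟ₛ Y) (_⊆? X) F)
              (trans (count-cong _ (_≟ₛ Y) F (λ _ → proj₁) λ { _ refl → refl , Y⊆X }) (count-≟-⊆X≡s Y⊆X ∣Y∣≡k))

      count-filter-outside : ∀ {Y} → ¬ (Y ⊆ X × ∣ Y ∣ ≡ k) → count (_≟ₛ Y) (filter (_⊆? X) F) ≡ 0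
      count-filter-outside {Y} ¬inside =
        trans (count-filter (_≟ₛ Y) (_⊆? X) F)
              (count-none _ F λ { E∈F (refl , E⊆X) → ¬inside (E⊆X , ∣edge∣≡k E∈F) })

      F↭image-standard : F ↭ map (image (enumerate X e)) (standard k s)
      F↭image-standard = subst (_↭ map (image (enumerate X e)) (standard k s)) (filter-complete (_⊆? X) same-length) filter↭
        where
        filter↭ : filter (_⊆? X) F ↭ map (image (enumerate X e)) (standard k s)
        filter↭ = subst (filter (_⊆? X) F ↭_) (sym (map-cong (image-enumerate X e) (standard k s)))
          (count-≟-≡⇒↭ _≟ₛ_ _ _ λ Y → case (Y ⊆? X) ×-dec (∣ Y ∣ ≟ k) of λ where
            (yes (Y⊆X , ∣Y∣≡k)) →
              trans (count-filter-inside Y⊆X ∣Y∣≡k) (sym (count-embed-standard-inside Y⊆X ∣Y∣≡k))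
            (no ¬inside) → trans (count-filter-outside ¬inside) (sym (count-embed-standard-outside ¬inside)))
        same-length : length (filter (_⊆? X) F) ≡ length F
        same-length = begin
          length (filter (_⊆? X) F)                       ≡⟨ ↭-length filter↭ ⟩
          length (map (image (enumerate X e)) (standard k s)) ≡⟨ length-map _ (standard k s) ⟩
          length (standard k s)                           ≡⟨ length-standard k s ⟩
          s * ((2 * k) C k)                               ≡⟨ tight ⟨
          length F                                        ∎
          where open ≡-Reasoning

    extremal : s ≢ 0 → Σ (Fin (2 * k) → Fin n) λ f → Injective _≡_ _≡_ f × F ↭ map (image f) (standard k s)
    extremal s≢0
      with A₀ , A₀∈F ← length≢0⇒∃∈ F (≢-nonZero⁻¹ _ {{m*n≢0 s _ {{≢-nonZero s≢0}} {{2kCk≢0 k}}}} ∘ trans (sym tight))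
      =
      enumerate (X A₀∈F) (∣X∣≡2k A₀∈F) , enumerate-injective (X A₀∈F) (∣X∣≡2k A₀∈F) , F↭image-standard A₀∈F

theorem2p1 : (k s : ℕ) → 1 ≤ k → 1 ≤ s →
    ((n : ℕ) (F : MultiHypergraph n) → Uniform k F → AlmostIntersecting 1 s F →
      length F ≤ s * ((2 * k) C k)
      × (length F ≡ s * ((2 * k) C k) →
          Σ (Fin (2 * k) → Fin n) (λ f → Injective _≡_ _≡_ f × (F ↭ map (image f) (standard k s)))))
    × Uniform k (standard k s)
    × length (standard k s) ≡ s * ((2 * k) C k)
    × SAlmostIntersecting s (standard k s)
theorem2p1 k s 1≤k 1≤s =
  (λ n F uniform almost → bound k≢0 uniform almost , λ tight → extremal k≢0 uniform almost tight s≢0) ,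
  standard-uniform k s , length-standard k s , standard-almostIntersecting k s
  where
  k≢0 : k ≢ 0
  k≢0 = n>0⇒n≢0 1≤k
  s≢0 : s ≢ 0
  s≢0 = n>0⇒n≢0 1≤s
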